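{- Let $N_i=4^{i+1}$ for $i\ge 1$ and $h(n)=\lfloor n\cdot 10^{ -8}\rfloor$. Let $\mathcal{S}$ be a selection mechanism which, for each $k\ge 1$ and any given sets of integers $B_i,C_i,G_i,H_i$ ($1\le i\le k-1$), produces sets $$G_k\subseteq \bigcup_{i=1}^{k-1}\bigl(B_i\cup(N_{i+1}-G_i)\bigr),\qquad H_k\subseteq \bigcup_{i=1}^{k-1}\bigl(C_i\cup(N_{i+1}-H_i)\bigr).$$ Suppose that for all $k$ and all inputs, $G_k$ and $H_k$ are disjoint and no element of $F_k:=G_k\cup H_k$ is greater than $N_k$. Then there exist sets $B_1,B_2,\ldots$ and $C_1,C_2,\ldots$ such that, letting $G_k,H_k$ be the outputs of $\mathcal{S}$ on these inputs (including the previously produced $G_i,H_i$ for $i<k$), the sets $$B:=\bigcup_{i=1}^{\infty}\bigl(B_i\cup(N_{i+1}-G_i)\bigr),\qquad C:=\bigcup_{i=1}^{\infty}\bigl(C_i\cup(N_{i+1}-H_i)\bigr)$$ satisfy: 1. each $B_k$ and each $C_k$ consists of positive integers strictly between $N_k$ and $N_{k+1}$; 2. $B\cap C=\emptyset$; 3. $r'_B(n)\ge h(n)$ and $r'_C(n)\ge h(n)$ for all sufficiently large $n\in\mathbb{N}\setminus\{N_i: i\ge 1\}$; 4. for all sufficiently large $k$, every representation $N_{k+1}=a+a'$ with $a,a'\in B\cup C$ has $a\in F_k$ or $a'\in F_k$.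
   Context: For a set $S$ of integers and an integer $m$, $m-S=\{m-s: s\in S\}$. For $A\subseteq\mathbb{N}$, $r'_A(n)$ denotes the number of pairs $(a,a')\in A^2$ with $a+a'=n$ and $a'/a\in[1,100]$. -}

module Defs where

open import Level using (0ℓ)
open import Data.Nat as ℕ using (ℕ; zero; suc)
open import Data.Integer as ℤ using (ℤ; +_; _+_; _-_; _*_; _<_; _≤_)
open import Data.Fin using (Fin; toℕ)
open import Data.Vec using (Vec; []; _∷ʳ_; lookup)
open import Data.Product using (Σ; ∃-syntax; _×_; _,_; proj₁; proj₂)
open import Data.Sum using (_⊎_)
open import Data.Empty using (⊥)
open import Relation.Unary using (Pred; _∈_)
open import Function.Definitions using (Injective)
open import Relation.Binary.PropositionalEquality using (_≡_)

ISet : Set₁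
ISet = Pred ℤ 0ℓ

N : ℕ → ℤ
N i = + (4 ℕ.^ suc i)

h : ℕ → ℕ
h n = n ℕ./ 100000000

_-ˢ_ : ℤ → ISet → ISet
(m -ˢ S) x = (m - x) ∈ S

-- Given m (= k - 1) and the sets B_i, C_i, G_i, H_i
-- for the stages i = 1, …, m (the Fin m index j stands for stage toℕ j + 1),
-- it produces the pair (G_k , H_k) for stage k = m + 1.
Mech : Set₁
Mech = (m : ℕ) → (Fin m → ISet) → (Fin m → ISet) → (Fin m → ISet) → (Fin m → ISet)
       → ISet × ISet

-- The requirements on the mechanism: the subset constraints on G_k, H_k
-- (k = m+1; stage i = toℕ j + 1, so N_{i+1} = N (toℕ j + 2)),
-- disjointness of G_k and H_k, and all elements of F_k = G_k ∪ H_k are ≤ N_k.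
ValidMech : Mech → Set₁
ValidMech S =
  ∀ m (b c g hh : Fin m → ISet) →
    let G′ = proj₁ (S m b c g hh)
        H′ = proj₂ (S m b c g hh)
    in (∀ x → x ∈ G′ → ∃[ j ] (x ∈ b j ⊎ x ∈ (N (suc (suc (toℕ j))) -ˢ g j)))
     × (∀ x → x ∈ H′ → ∃[ j ] (x ∈ c j ⊎ x ∈ (N (suc (suc (toℕ j))) -ˢ hh j)))
     × (∀ x → x ∈ G′ → x ∈ H′ → ⊥)
     × (∀ x → (x ∈ G′ ⊎ x ∈ H′) → x ≤ N (suc m))

-- Running the mechanism on given sequences B_i, C_i (i ≥ 1; index 0 unused).
module Run (S : Mech) (Bs Cs : ℕ → ISet) where

  step : (m : ℕ) → Vec (ISet × ISet) m → ISet × ISet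
  step m v = S m (λ j → Bs (suc (toℕ j))) (λ j → Cs (suc (toℕ j)))
                 (λ j → proj₁ (lookup v j)) (λ j → proj₂ (lookup v j))

  hist : (m : ℕ) → Vec (ISet × ISet) m
  hist zero = []
  hist (suc m) = hist m ∷ʳ step m (hist m)

  -- G_k, H_k for k ≥ 1 (the value at index 0 is never used)
  Gs : ℕ → ISet
  Gs zero = λ _ → ⊥
  Gs (suc m) = proj₁ (step m (hist m))

  Hs : ℕ → ISet
  Hs zero = λ _ → ⊥
  Hs (suc m) = proj₂ (step m (hist m))

  Fs : ℕ → ISet
  Fs k x = x ∈ Gs k ⊎ x ∈ Hs k

  BigB : ISet
  BigB x = ∃[ i ] (x ∈ Bs (suc i) ⊎ x ∈ (N (suc (suc i)) -ˢ Gs (suc i)))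

  BigC : ISet
  BigC x = ∃[ i ] (x ∈ Cs (suc i) ⊎ x ∈ (N (suc (suc i)) -ˢ Hs (suc i)))

-- (a , a') is counted by r'_A(n): a, a' ∈ A, a + a' = n, a'/a ∈ [1,100]
-- (a'/a defined requires a ≠ 0; with a + a' = n ≥ 0 this means 0 < a ≤ a' ≤ 100 a).
Rep : ISet → ℕ → ℤ × ℤ → Set
Rep A n (a , a′) = a ∈ A × a′ ∈ A × a + a′ ≡ + n × + 0 < a × a ≤ a′ × a′ ≤ + 100 * a

r′≥ : ISet → ℕ → ℕ → Set
r′≥ A n k = Σ (Fin k → ℤ × ℤ) λ f → Injective _≡_ _≡_ f × (∀ i → Rep A n (f i))

module Submission where

-- For the stage k = e + 3 put u = 4^e, so N_k = 256u and N_{k+1} = 1024u.  B_k and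
-- C_k consist of numbers 512u ± s with offsets s ∈ [16u, 256u), the sign being a
-- function of s; hence no two of them sum to N_{k+1}.  They lie in (N_k, 3N_k), while
-- N_{k+1} − G_k and N_{k+1} − H_k lie in [3N_k, N_{k+1}); sorting elements into the
-- bands [4^p, 4^(p+1)) then gives B ∩ C = ∅ (from G_k ∩ H_k = ∅) and property 4.
-- For s < 48u the sign is the Thue–Morse bit tm(s), so each s with tm(s) = 0 and
-- tm(s + t) = 1 yields n = (512u − s) + (512u + s + t) = 1024u + t, and similarly for
-- 1024u − t; as tm(w) ≠ tm(w + t) for at least 2u/3 of the w < 4u, this gives enough
-- representations of n near 1024u.  For s ≥ 48u the class of 512u ± s is decided by
-- its residue mod 8, and a finite list of pairings of such solid blocks covers the
-- remaining n in each band [4^q, 4^(q+1)).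

module Preliminaries where

  open import Data.Bool.Base using (true; false; not; _xor_; T)
  open import Data.Bool.Properties using (not-involutive)
  open import Data.Fin.Base as Fin using (Fin; toℕ)
  open import Data.Integer.Base as ℤ using (-[1+_]; +<+)
  import Data.Integer.Properties as ℤ
  open import Data.Integer.Tactic.RingSolver using () renaming (solve-∀ to ℤ-solve-∀)
  open import Data.Nat.Base
  open import Data.Nat.Properties
  open import Data.Nat.Tactic.RingSolver using (solve-∀)
  open import Data.Product.Base using (Σ; _×_; _,_)
  open import Data.Sum.Base using (_⊎_; inj₁; inj₂; [_,_]′)
  open import Data.Vec.Base using (Vec; []; _∷_; _∷ʳ_; lookup)
  open import Relation.Binary.PropositionalEquality
  open import Relation.Nullary.Decidable using (does; dec-true; dec-false)
  open import Relation.Nullary.Negation using (contradiction)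

  not-xor-not : ∀ a b → not a xor not b ≡ a xor b
  not-xor-not true  b = refl
  not-xor-not false b = not-involutive b

  xor-shuffle : ∀ a σ b → (a xor σ) xor b ≡ σ xor (a xor b)
  xor-shuffle true  true  b = sym (not-involutive b)
  xor-shuffle true  false b = refl
  xor-shuffle false σ     b = refl

  scale-≤ : ∀ m n u → {T (m ≤ᵇ n)} → m * u ≤ n * u
  scale-≤ m n u {m≤ᵇn} = *-monoˡ-≤ u (≤ᵇ⇒≤ m n m≤ᵇn)

  does-< : ∀ {s m} → s < m → does (s <? m) ≡ true
  does-< {s} {m} = dec-true (s <? m)

  does-≥ : ∀ {s m} → m ≤ s → does (s <? m) ≡ false
  does-≥ {s} {m} m≤s = dec-false (s <? m) (≤⇒≯ m≤s)

  2*m≡m+m : ∀ m → 2 * m ≡ m + m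
  2*m≡m+m m = cong (m +_) (+-identityʳ m)

  4*m≡3*m+m : ∀ m → 4 * m ≡ 3 * m + m
  4*m≡3*m+m = solve-∀

  m+m<2*n⇒m<n : ∀ {m n} → m + m < 2 * n → m < n
  m+m<2*n⇒m<n {m} {n} m+m<2n =
    ≰⇒> (λ n≤m → <⇒≱ m+m<2n (subst (_≤ m + m) (sym (2*m≡m+m n)) (+-mono-≤ n≤m n≤m)))

  +-<-swap : ∀ {a b c d} → a + b ≡ c + d → a < c → d < b
  +-<-swap e a<c = ≰⇒> λ b≤d → <⇒≢ (+-mono-<-≤ a<c b≤d) e

  complement-< : ∀ {y s} a b u → y + s ≡ (a + b) * u → y < a * u → b * u < s
  complement-< a b u e = +-<-swap (trans e (*-distribʳ-+ u a b))

  complement-> : ∀ {y s} a b u → y + s ≡ (a + b) * u → a * u < y → s < b * u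
  complement-> a b u e = +-<-swap (trans (sym (*-distribʳ-+ u a b)) (sym e))

  complement-band : ∀ {y g P} → y + g ≡ 4 * P → 1 ≤ g → g ≤ P → 3 * P ≤ y × y < 4 * P
  complement-band {y} {g} {P} y+g≡4P 1≤g g≤P =
      ≮⇒≥ (λ y<3P → <⇒≢ (+-mono-<-≤ y<3P g≤P) (trans y+g≡4P (4*m≡3*m+m P)))
    , <-≤-trans (m<m+n y 1≤g) (≤-reflexive y+g≡4P)

  power-band : ∀ m → 1 < m → ∀ n → Σ ℕ λ q → m ^ q ≤ suc n × suc n < m ^ suc q
  power-band m 1<m zero    = 0 , ≤-refl , subst (1 <_) (sym (*-identityʳ m)) 1<m
  power-band m 1<m (suc n) with power-band m 1<m n
  ... | q , lo , hi = [ stay , climb ]′ (<-≤-connex (suc (suc n)) (m ^ suc q))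
    where
    stay : suc (suc n) < m ^ suc q → Σ ℕ λ q → m ^ q ≤ suc (suc n) × suc (suc n) < m ^ suc q
    stay hi′ = q , ≤-trans lo (n≤1+n _) , hi′
    climb : m ^ suc q ≤ suc (suc n) → Σ ℕ λ q → m ^ q ≤ suc (suc n) × suc (suc n) < m ^ suc q
    climb lo′ = suc q , lo′ , ≤-<-trans hi (^-monoʳ-< m 1<m (n<1+n (suc q)))

  power-band-unique : ∀ m .{{_ : NonZero m}} {p q y} →
                      m ^ p ≤ y → y < m ^ suc p → m ^ q ≤ y → y < m ^ suc q → p ≡ q
  power-band-unique m m^p≤y y<m^[1+p] m^q≤y y<m^[1+q] =
    ≤-antisym (below m^p≤y y<m^[1+q]) (below m^q≤y y<m^[1+p])
    where
    below : ∀ {i j y} → m ^ i ≤ y → y < m ^ suc j → i ≤ j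
    below m^i≤y y<m^[1+j] = ≮⇒≥ (λ j<i → <⇒≱ y<m^[1+j] (≤-trans (^-monoʳ-≤ m j<i) m^i≤y))

  lookup-∷ʳ : ∀ {a} {A : Set a} {n} (xs : Vec A n) x (i : Fin (suc n)) →
              (Σ (Fin n) λ j → toℕ j ≡ toℕ i × lookup (xs ∷ʳ x) i ≡ lookup xs j)
            ⊎ (toℕ i ≡ n × lookup (xs ∷ʳ x) i ≡ x)
  lookup-∷ʳ []       x Fin.zero    = inj₂ (refl , refl)
  lookup-∷ʳ (y ∷ xs) x Fin.zero    = inj₁ (Fin.zero , refl , refl)
  lookup-∷ʳ (y ∷ xs) x (Fin.suc i) with lookup-∷ʳ xs x i
  ... | inj₁ (j , j≡i , e) = inj₁ (Fin.suc j , cong suc j≡i , e)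
  ... | inj₂ (i≡n , e)     = inj₂ (cong suc i≡n , e)

  i-j<i⇒0<j : ∀ i j → i ℤ.- j ℤ.< i → ℤ.+ 0 ℤ.< j
  i-j<i⇒0<j i (ℤ.+ zero)    i<i = contradiction (subst (ℤ._< i) (ℤ.+-identityʳ i) i<i) (ℤ.<-irrefl refl)
  i-j<i⇒0<j i (ℤ.+ (suc n)) _   = +<+ (s≤s z≤n)
  i-j<i⇒0<j i -[1+ n ]      lt  = contradiction lt (ℤ.≤⇒≯ (ℤ.i≤i+j i (ℤ.+ suc n)))

  +m-i≡+n⇒i≡+[m∸n] : ∀ m i n → ℤ.+ m ℤ.- i ≡ ℤ.+ n → n ≤ m → i ≡ ℤ.+ (m ∸ n)
  +m-i≡+n⇒i≡+[m∸n] m i n m-i≡n n≤m = begin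
    i                           ≡⟨ i≡j-[j-i] (ℤ.+ m) i ⟩
    ℤ.+ m ℤ.- (ℤ.+ m ℤ.- i)     ≡⟨ cong (λ k → ℤ.+ m ℤ.- k) m-i≡n ⟩
    ℤ.+ m ℤ.- ℤ.+ n             ≡⟨ ℤ.m-n≡m⊖n m n ⟩
    m ℤ.⊖ n                     ≡⟨ ℤ.⊖-≥ n≤m ⟩
    ℤ.+ (m ∸ n)                 ∎
    where
    open ≡-Reasoning
    i≡j-[j-i] : ∀ j i → i ≡ j ℤ.- (j ℤ.- i)
    i≡j-[j-i] = ℤ-solve-∀


module ThueMorse where

  open import Data.Bool.Base using (Bool; true; false; not; _xor_; if_then_else_)
  open import Data.Bool.Properties using (xor-same; xor-identityʳ; not-involutive; not-distribˡ-xor; not-distribʳ-xor)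
  open import Data.Fin.Base as Fin using (Fin)
  open import Data.Nat.Base
  open import Data.Nat.Properties
  open import Data.Nat.Tactic.RingSolver using (solve-∀; solve)
  open import Data.List.Base using (_∷_; [])
  open import Data.Product.Base using (Σ; _×_; _,_; proj₁; proj₂)
  open import Function.Base using (_∘_)
  open import Function.Definitions using (Injective)
  open import Relation.Binary.PropositionalEquality
  open import Relation.Nullary.Negation using (contradiction)
  open Preliminaries

  data EvenOdd : ℕ → Set where
    even : ∀ m → EvenOdd (m + m)
    odd  : ∀ m → EvenOdd (suc (m + m))

  evenOdd : ∀ n → EvenOdd n
  evenOdd zero          = even 0
  evenOdd (suc zero)    = odd 0
  evenOdd (suc (suc n)) with evenOdd n
  ... | even m = subst EvenOdd (cong suc (+-suc m m)) (even (suc m))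
  ... | odd m  = subst EvenOdd (cong (suc ∘ suc) (+-suc m m)) (odd (suc m))

  odd? : ℕ → Bool
  odd? zero    = false
  odd? (suc n) = not (odd? n)

  odd?-double : ∀ m → odd? (m + m) ≡ false
  odd?-double zero    = refl
  odd?-double (suc m) rewrite +-suc m m | not-involutive (odd? (m + m)) = odd?-double m

  ⌊1+n+n/2⌋≡n : ∀ n → ⌊ suc (n + n) /2⌋ ≡ n
  ⌊1+n+n/2⌋≡n zero    = refl
  ⌊1+n+n/2⌋≡n (suc n) rewrite +-suc n n = cong suc (⌊1+n+n/2⌋≡n n)

  -- The Thue–Morse bit (parity of the binary digit sum), computed with fuel;
  -- any fuel f ≥ n gives the same value.
  tmWith : ℕ → ℕ → Bool
  tmWith zero    n = false
  tmWith (suc f) n = odd? n xor tmWith f ⌊ n /2⌋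

  tm : ℕ → Bool
  tm n = tmWith n n

  tmWith-zero : ∀ f → tmWith f 0 ≡ false
  tmWith-zero zero    = refl
  tmWith-zero (suc f) = tmWith-zero f

  ⌊1+n/2⌋≤n : ∀ n → ⌊ suc n /2⌋ ≤ n
  ⌊1+n/2⌋≤n n = ≤-pred (⌊n/2⌋<n n)

  tmWith-fuel : ∀ {f g} n → n ≤ f → n ≤ g → tmWith f n ≡ tmWith g n
  tmWith-fuel {f} {g} zero _ _ = trans (tmWith-zero f) (sym (tmWith-zero g))
  tmWith-fuel {suc f} {suc g} (suc n) n<f n<g =
    cong (odd? (suc n) xor_) (tmWith-fuel ⌊ suc n /2⌋ (halve n<f) (halve n<g))
    where
    halve : ∀ {k} → suc n ≤ suc k → ⌊ suc n /2⌋ ≤ k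
    halve n<k = ≤-trans (⌊1+n/2⌋≤n n) (≤-pred n<k)

  tm-suc : ∀ n → tm (suc n) ≡ odd? (suc n) xor tm ⌊ suc n /2⌋
  tm-suc n = cong (odd? (suc n) xor_) (tmWith-fuel ⌊ suc n /2⌋ (⌊1+n/2⌋≤n n) ≤-refl)

  tm-even : ∀ m → tm (m + m) ≡ tm m
  tm-even zero    = refl
  tm-even (suc m) = begin
    tm (suc m + suc m)
      ≡⟨ tm-suc (m + suc m) ⟩
    odd? (suc m + suc m) xor tm ⌊ suc m + suc m /2⌋
      ≡⟨ cong₂ _xor_ (odd?-double (suc m)) (cong tm (sym (n≡⌊n+n/2⌋ (suc m)))) ⟩
    tm (suc m)
      ∎
    where open ≡-Reasoning

  tm-odd : ∀ m → tm (suc (m + m)) ≡ not (tm m)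
  tm-odd m = begin
    tm (suc (m + m))
      ≡⟨ tm-suc (m + m) ⟩
    odd? (suc (m + m)) xor tm ⌊ suc (m + m) /2⌋
      ≡⟨ cong₂ _xor_ (cong not (odd?-double m)) (cong tm (⌊1+n+n/2⌋≡n m)) ⟩
    not (tm m)
      ∎
    where open ≡-Reasoning

  tm-concat : ∀ j c {w} → w < 2 ^ j → tm (c * 2 ^ j + w) ≡ tm c xor tm w
  tm-concat zero c {zero} _ = begin
    tm (c * 1 + 0)   ≡⟨ cong tm (trans (+-identityʳ _) (*-identityʳ c)) ⟩
    tm c             ≡⟨ xor-identityʳ (tm c) ⟨
    tm c xor false   ∎
    where open ≡-Reasoning
  tm-concat zero c {suc w} (s≤s ())
  tm-concat (suc j) c {w} w<2P with evenOdd w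
  ... | even m = begin
    tm (c * (2 * P) + (m + m))                 ≡⟨ cong tm (shift c m P) ⟩
    tm ((c * P + m) + (c * P + m))             ≡⟨ tm-even (c * P + m) ⟩
    tm (c * P + m)                             ≡⟨ tm-concat j c (m+m<2*n⇒m<n w<2P) ⟩
    tm c xor tm m                              ≡⟨ cong (tm c xor_) (tm-even m) ⟨
    tm c xor tm (m + m)                        ∎
    where
    open ≡-Reasoning
    P : ℕ
    P = 2 ^ j
    shift : ∀ c m P → c * (2 * P) + (m + m) ≡ (c * P + m) + (c * P + m)
    shift = solve-∀
  ... | odd m = begin
    tm (c * (2 * P) + suc (m + m))             ≡⟨ cong tm (shift c m P) ⟩
    tm (suc ((c * P + m) + (c * P + m)))       ≡⟨ tm-odd (c * P + m) ⟩
    not (tm (c * P + m))                       ≡⟨ cong not (tm-concat j c (m+m<2*n⇒m<n (<-trans (n<1+n _) w<2P))) ⟩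
    not (tm c xor tm m)                        ≡⟨ not-distribʳ-xor (tm c) (tm m) ⟩
    tm c xor not (tm m)                        ≡⟨ cong (tm c xor_) (tm-odd m) ⟨
    tm c xor tm (suc (m + m))                  ∎
    where
    open ≡-Reasoning
    P : ℕ
    P = 2 ^ j
    shift : ∀ c m P → c * (2 * P) + suc (m + m) ≡ suc ((c * P + m) + (c * P + m))
    shift = solve-∀

  bit : Bool → ℕ
  bit b = if b then 1 else 0

  count : (ℕ → Bool) → ℕ → ℕ
  count f zero    = 0
  count f (suc R) = bit (f R) + count f R

  count-cong : ∀ {f g} → (∀ v → f v ≡ g v) → ∀ R → count f R ≡ count g R
  count-cong f≗g zero    = refl
  count-cong f≗g (suc R) = cong₂ (λ b c → bit b + c) (f≗g R) (count-cong f≗g R)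

  count-complement : ∀ f R → count f R + count (not ∘ f) R ≡ R
  count-complement f zero    = refl
  count-complement f (suc R) with f R
  ... | true  = cong suc (count-complement f R)
  ... | false = trans (+-suc _ _) (cong suc (count-complement f R))

  count-double : ∀ f R → count f (R + R) ≡ count (λ v → f (v + v)) R + count (λ v → f (suc (v + v))) R
  count-double f zero    = refl
  count-double f (suc R) rewrite +-suc R R = begin
    bit (f (suc (R + R))) + (bit (f (R + R)) + count f (R + R))
      ≡⟨ cong (λ c → bit (f (suc (R + R))) + (bit (f (R + R)) + c)) (count-double f R) ⟩
    bit (f (suc (R + R))) + (bit (f (R + R)) + (count (λ v → f (v + v)) R + count (λ v → f (suc (v + v))) R))
      ≡⟨ regroup (bit (f (suc (R + R)))) (bit (f (R + R))) _ _ ⟩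
    (bit (f (R + R)) + count (λ v → f (v + v)) R) + (bit (f (suc (R + R))) + count (λ v → f (suc (v + v))) R)
      ∎
    where
    open ≡-Reasoning
    regroup : ∀ a b c d → a + (b + (c + d)) ≡ (b + c) + (a + d)
    regroup = solve-∀

  Enumeration : (ℕ → Bool) → ℕ → ℕ → Set
  Enumeration f R K = Σ (Fin K → ℕ) λ g → Injective _≡_ _≡_ g × (∀ i → g i < R × f (g i) ≡ true)

  enumeration-suc : ∀ {f R K} → Enumeration f R K → Enumeration f (suc R) K
  enumeration-suc (g , g-injective , g-ok) = g , g-injective , λ i → m<n⇒m<1+n (proj₁ (g-ok i)) , proj₂ (g-ok i)

  enumeration-cons : ∀ {f R K} → f R ≡ true → Enumeration f R K → Enumeration f (suc R) (suc K)
  enumeration-cons {f} {R} {K} fR (g , g-injective , g-ok) = g′ , g′-injective , g′-ok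
    where
    g′ : Fin (suc K) → ℕ
    g′ Fin.zero    = R
    g′ (Fin.suc i) = g i
    g′-injective : Injective _≡_ _≡_ g′
    g′-injective {Fin.zero}  {Fin.zero}  _ = refl
    g′-injective {Fin.zero}  {Fin.suc j} e = contradiction (sym e) (<⇒≢ (proj₁ (g-ok j)))
    g′-injective {Fin.suc i} {Fin.zero}  e = contradiction e (<⇒≢ (proj₁ (g-ok i)))
    g′-injective {Fin.suc i} {Fin.suc j} e = cong Fin.suc (g-injective e)
    g′-ok : ∀ i → g′ i < suc R × f (g′ i) ≡ true
    g′-ok Fin.zero    = ≤-refl , fR
    g′-ok (Fin.suc i) = m<n⇒m<1+n (proj₁ (g-ok i)) , proj₂ (g-ok i)

  count-enumerate : ∀ f R {K} → K ≤ count f R → Enumeration f R K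
  count-enumerate f R       {zero}  _  = (λ ()) , (λ { {()} }) , (λ ())
  count-enumerate f (suc R) {suc K} K≤ with f R in fR
  ... | false = enumeration-suc {f} (count-enumerate f R K≤)
  ... | true  = enumeration-cons fR (count-enumerate f R (≤-pred K≤))

  mismatch : ℕ → ℕ → Bool
  mismatch t w = tm w xor tm (w + t)

  mismatches : ℕ → ℕ → ℕ
  mismatches R t = count (mismatch t) R

  mismatch-even-even : ∀ t v → mismatch (t + t) (v + v) ≡ mismatch t v
  mismatch-even-even t v = cong₂ _xor_ (tm-even v) (trans (cong tm (shift v t)) (tm-even (v + t)))
    where
    shift : ∀ v t → v + v + (t + t) ≡ (v + t) + (v + t)
    shift = solve-∀

  mismatch-even-odd : ∀ t v → mismatch (t + t) (suc (v + v)) ≡ mismatch t v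
  mismatch-even-odd t v = begin
    tm (suc (v + v)) xor tm (suc (v + v) + (t + t))
      ≡⟨ cong₂ _xor_ (tm-odd v) (trans (cong tm (shift v t)) (tm-odd (v + t))) ⟩
    not (tm v) xor not (tm (v + t))
      ≡⟨ not-xor-not (tm v) (tm (v + t)) ⟩
    tm v xor tm (v + t)
      ∎
    where
    open ≡-Reasoning
    shift : ∀ v t → suc (v + v) + (t + t) ≡ suc ((v + t) + (v + t))
    shift = solve-∀

  mismatch-odd-even : ∀ t v → mismatch (suc (t + t)) (v + v) ≡ not (mismatch t v)
  mismatch-odd-even t v = begin
    tm (v + v) xor tm (v + v + suc (t + t))
      ≡⟨ cong₂ _xor_ (tm-even v) (trans (cong tm (shift v t)) (tm-odd (v + t))) ⟩
    tm v xor not (tm (v + t))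
      ≡⟨ not-distribʳ-xor (tm v) (tm (v + t)) ⟨
    not (tm v xor tm (v + t))
      ∎
    where
    open ≡-Reasoning
    shift : ∀ v t → v + v + suc (t + t) ≡ suc ((v + t) + (v + t))
    shift = solve-∀

  mismatch-odd-odd : ∀ t v → mismatch (suc (t + t)) (suc (v + v)) ≡ not (mismatch (suc t) v)
  mismatch-odd-odd t v = begin
    tm (suc (v + v)) xor tm (suc (v + v) + suc (t + t))
      ≡⟨ cong₂ _xor_ (tm-odd v) (trans (cong tm (shift v t)) (tm-even (v + suc t))) ⟩
    not (tm v) xor tm (v + suc t)
      ≡⟨ not-distribˡ-xor (tm v) (tm (v + suc t)) ⟨
    not (tm v xor tm (v + suc t))
      ∎
    where
    open ≡-Reasoning
    shift : ∀ v t → suc (v + v) + suc (t + t) ≡ (v + suc t) + (v + suc t)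
    shift = solve-∀

  mismatches-zero : ∀ R → mismatches R 0 ≡ 0
  mismatches-zero zero    = refl
  mismatches-zero (suc R) rewrite +-identityʳ R | xor-same (tm R) = mismatches-zero R

  mismatches-even : ∀ R t → mismatches (R + R) (t + t) ≡ mismatches R t + mismatches R t
  mismatches-even R t = trans (count-double (mismatch (t + t)) R)
    (cong₂ _+_ (count-cong (mismatch-even-even t) R) (count-cong (mismatch-even-odd t) R))

  mismatches-odd : ∀ R t → mismatches (R + R) (suc (t + t)) + mismatches R t + mismatches R (suc t) ≡ R + R
  mismatches-odd R t = begin
    mismatches (R + R) (suc (t + t)) + D t + D (suc t)
      ≡⟨ cong (λ x → x + D t + D (suc t)) (trans (count-double (mismatch (suc (t + t))) R)
           (cong₂ _+_ (count-cong (mismatch-odd-even t) R) (count-cong (mismatch-odd-odd t) R))) ⟩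
    D̅ t + D̅ (suc t) + D t + D (suc t)
      ≡⟨ regroup (D̅ t) (D̅ (suc t)) (D t) (D (suc t)) ⟩
    (D t + D̅ t) + (D (suc t) + D̅ (suc t))
      ≡⟨ cong₂ _+_ (count-complement (mismatch t) R) (count-complement (mismatch (suc t)) R) ⟩
    R + R ∎
    where
    open ≡-Reasoning
    D D̅ : ℕ → ℕ
    D  t = mismatches R t
    D̅ t = count (not ∘ mismatch t) R
    regroup : ∀ a b c d → a + b + c + d ≡ (c + a) + (d + b)
    regroup = solve-∀

  MismatchBounds : ℕ → ℕ → ℕ → Set
  MismatchBounds R D t = (R ≤ 3 * D + 2 * t) × (3 * D ≤ 2 * R + 2 * t)

  -- MismatchBounds R (mismatches R t) t holds for R a power of two and t ≥ 1, but the
  -- induction on R needs the sharper estimate at t = 1 alongside it.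
  UnitShiftBounds : ℕ → Set
  UnitShiftBounds R = (2 * R ≤ 3 * mismatches R 1 + 1) × (3 * mismatches R 1 ≤ 2 * R + 1)

  private
    unitShift-arith : ∀ R D D′ → D′ + D ≡ R + R → 2 * R ≤ 3 * D + 1 → 3 * D ≤ 2 * R + 1 →
                      (2 * (R + R) ≤ 3 * D′ + 1) × (3 * D′ ≤ 2 * (R + R) + 1)
    unitShift-arith R D D′ sum lower upper = lower′ , upper′
      where
      open ≤-Reasoning
      lower′ : 2 * (R + R) ≤ 3 * D′ + 1
      lower′ = +-cancelʳ-≤ (3 * D) _ _ (begin
        2 * (R + R) + 3 * D           ≤⟨ +-monoʳ-≤ (2 * (R + R)) upper ⟩
        2 * (R + R) + (2 * R + 1)     ≡⟨ solve (R ∷ []) ⟩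
        3 * (R + R) + 1               ≡⟨ cong (λ x → 3 * x + 1) sum ⟨
        3 * (D′ + D) + 1              ≡⟨ solve (D′ ∷ D ∷ []) ⟩
        3 * D′ + 1 + 3 * D            ∎)
      upper′ : 3 * D′ ≤ 2 * (R + R) + 1
      upper′ = +-cancelʳ-≤ (2 * R) _ _ (begin
        3 * D′ + 2 * R                ≤⟨ +-monoʳ-≤ (3 * D′) lower ⟩
        3 * D′ + (3 * D + 1)          ≡⟨ solve (D′ ∷ D ∷ []) ⟩
        3 * (D′ + D) + 1              ≡⟨ cong (λ x → 3 * x + 1) sum ⟩
        3 * (R + R) + 1               ≡⟨ solve (R ∷ []) ⟩
        2 * (R + R) + 1 + 2 * R       ∎)

    unitShift⇒bounds : ∀ R D → 2 * R ≤ 3 * D + 1 → 3 * D ≤ 2 * R + 1 → MismatchBounds R D 1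
    unitShift⇒bounds R D lower upper =
        ≤-trans (m≤m+n R (R + 0)) (≤-trans lower (+-monoʳ-≤ (3 * D) (n≤1+n 1)))
      , ≤-trans upper (+-monoʳ-≤ (2 * R) (n≤1+n 1))

    bounds-even : ∀ R D t → MismatchBounds R D t → MismatchBounds (R + R) (D + D) (t + t)
    bounds-even R D t (lower , upper) =
        (begin
          R + R                                   ≤⟨ +-mono-≤ lower lower ⟩
          (3 * D + 2 * t) + (3 * D + 2 * t)       ≡⟨ solve (D ∷ t ∷ []) ⟩
          3 * (D + D) + 2 * (t + t)               ∎)
      , (begin
          3 * (D + D)                             ≡⟨ solve (D ∷ []) ⟩
          3 * D + 3 * D                           ≤⟨ +-mono-≤ upper upper ⟩
          (2 * R + 2 * t) + (2 * R + 2 * t)       ≡⟨ solve (R ∷ t ∷ []) ⟩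
          2 * (R + R) + 2 * (t + t)               ∎)
      where open ≤-Reasoning

    bounds-odd : ∀ R D′ D₀ D₁ t → D′ + D₀ + D₁ ≡ R + R → MismatchBounds R D₀ t → MismatchBounds R D₁ (suc t) →
                 MismatchBounds (R + R) D′ (suc (t + t))
    bounds-odd R D′ D₀ D₁ t sum (lower₀ , upper₀) (lower₁ , upper₁) = lower , upper
      where
      open ≤-Reasoning
      lower : R + R ≤ 3 * D′ + 2 * suc (t + t)
      lower = +-cancelʳ-≤ (3 * D₀ + 3 * D₁) _ _ (begin
        R + R + (3 * D₀ + 3 * D₁)                   ≤⟨ +-monoʳ-≤ (R + R) (+-mono-≤ upper₀ upper₁) ⟩
        R + R + ((2 * R + 2 * t) + (2 * R + 2 * suc t))
                                                    ≡⟨ solve (R ∷ t ∷ []) ⟩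
        3 * (R + R) + (4 * t + 2)                   ≡⟨ cong (λ x → 3 * x + (4 * t + 2)) sum ⟨
        3 * (D′ + D₀ + D₁) + (4 * t + 2)            ≡⟨ solve (D′ ∷ D₀ ∷ D₁ ∷ t ∷ []) ⟩
        3 * D′ + 2 * suc (t + t) + (3 * D₀ + 3 * D₁) ∎)
      upper : 3 * D′ ≤ 2 * (R + R) + 2 * suc (t + t)
      upper = +-cancelʳ-≤ (R + R) _ _ (begin
        3 * D′ + (R + R)                            ≤⟨ +-monoʳ-≤ (3 * D′) (+-mono-≤ lower₀ lower₁) ⟩
        3 * D′ + ((3 * D₀ + 2 * t) + (3 * D₁ + 2 * suc t))
                                                    ≡⟨ solve (D′ ∷ D₀ ∷ D₁ ∷ t ∷ []) ⟩
        3 * (D′ + D₀ + D₁) + (4 * t + 2)            ≡⟨ cong (λ x → 3 * x + (4 * t + 2)) sum ⟩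
        3 * (R + R) + (4 * t + 2)                   ≡⟨ solve (R ∷ t ∷ []) ⟩
        2 * (R + R) + 2 * suc (t + t) + (R + R)     ∎)

  unitShiftBounds-double : ∀ R → UnitShiftBounds R → UnitShiftBounds (R + R)
  unitShiftBounds-double R (lower , upper) = unitShift-arith R D D′ sum lower upper
    where
    open ≡-Reasoning
    D′ D : ℕ
    D′ = mismatches (R + R) 1
    D  = mismatches R 1
    sum : D′ + D ≡ R + R
    sum = begin
      D′ + D                        ≡⟨ cong (_+ D) (+-identityʳ D′) ⟨
      D′ + 0 + D                    ≡⟨ cong (λ x → D′ + x + D) (mismatches-zero R) ⟨
      D′ + mismatches R 0 + D       ≡⟨ mismatches-odd R 0 ⟩
      R + R                         ∎

  mismatchBounds-double : ∀ R → UnitShiftBounds (R + R) → (∀ t → 1 ≤ t → MismatchBounds R (mismatches R t) t) →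
                          ∀ t → 1 ≤ t → MismatchBounds (R + R) (mismatches (R + R) t) t
  mismatchBounds-double R unit bounds t 1≤t with evenOdd t
  ... | even (suc m) = subst (λ D → MismatchBounds (R + R) D (suc m + suc m)) (sym (mismatches-even R (suc m)))
                         (bounds-even R (mismatches R (suc m)) (suc m) (bounds (suc m) (s≤s z≤n)))
  ... | odd zero     = unitShift⇒bounds (R + R) (mismatches (R + R) 1) (proj₁ unit) (proj₂ unit)
  ... | odd (suc m)  = bounds-odd R (mismatches (R + R) (suc (suc m + suc m))) (mismatches R (suc m))
                         (mismatches R (suc (suc m))) (suc m) (mismatches-odd R (suc m))
                         (bounds (suc m) (s≤s z≤n)) (bounds (suc (suc m)) (s≤s z≤n))

  mismatchBounds : ∀ i → UnitShiftBounds (2 ^ i) × (∀ t → 1 ≤ t → MismatchBounds (2 ^ i) (mismatches (2 ^ i) t) t)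
  mismatchBounds zero    = (s≤s (s≤s z≤n) , ≤-refl) , base
    where
    bit≤1 : ∀ b → bit b ≤ 1
    bit≤1 true  = ≤-refl
    bit≤1 false = z≤n
    base : ∀ t → 1 ≤ t → MismatchBounds 1 (mismatches 1 t) t
    base (suc t) _ = ≤-trans (s≤s z≤n) (m≤n+m _ (3 * mismatches 1 (suc t)))
                   , ≤-trans (*-monoʳ-≤ 3 (≤-trans (≤-reflexive (+-identityʳ _)) (bit≤1 (mismatch (suc t) 0))))
                             (s≤s (s≤s (s≤s z≤n)))
  mismatchBounds (suc i) rewrite 2*m≡m+m (2 ^ i) =
    unit , mismatchBounds-double (2 ^ i) unit (proj₂ (mismatchBounds i))
    where
    unit : UnitShiftBounds (2 ^ i + 2 ^ i)
    unit = unitShiftBounds-double (2 ^ i) (proj₁ (mismatchBounds i))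

module Levels where

  open import Data.Bool.Base using (Bool; true; false; if_then_else_)
  open import Data.Nat.Base
  open import Data.Nat.Properties
  open import Data.Nat.Tactic.RingSolver using (solve)
  open import Data.List.Base using (_∷_; [])
  open import Data.Product.Base using (_×_; _,_)
  open import Data.Sum.Base using (_⊎_; inj₁; inj₂)
  open import Relation.Binary.PropositionalEquality
  open import Relation.Nullary.Decidable using (does)
  open import Relation.Nullary.Negation using (contradiction)
  open Preliminaries
  open ThueMorse

  inB-residue : ℕ → Bool
  inB-residue 0 = true
  inB-residue 1 = true
  inB-residue 3 = true
  inB-residue 4 = true
  inB-residue _ = false

  inB-mod8 : ℕ → Bool
  inB-mod8 y = inB-residue (y % 8)

  -- The level with unit u (u = 4^e at stage k = e + 3): an offset s ∈ [16u, 256u)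
  -- gives the element 512u + s if above u s and 512u − s otherwise, which goes
  -- into B if inB u s y and into C otherwise.
  above : ℕ → ℕ → Bool
  above u s = if does (s <? 48 * u) then tm s
              else if does (s <? 64 * u) then false
              else does (s <? 80 * u)

  inB : ℕ → ℕ → ℕ → Bool
  inB u s y = if does (s <? 32 * u) then true
              else if does (s <? 48 * u) then false
              else inB-mod8 y

  Placed : ℕ → ℕ → ℕ → Set
  Placed u s y = (above u s ≡ false × y + s ≡ 512 * u) ⊎ (above u s ≡ true × y ≡ 512 * u + s)

  record Member (b : Bool) (u y : ℕ) : Set where
    constructor member
    field
      offset      : ℕ
      offset≥16u  : 16 * u ≤ offset
      offset<256u : offset < 256 * u
      class       : inB u offset y ≡ b
      placed      : Placed u offset y

  private
    offset-pos : ∀ {u s} .{{_ : NonZero u}} → 16 * u ≤ s → 0 < s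
    offset-pos {u} 16u≤s = ≤-trans (>-nonZero⁻¹ u) (≤-trans (m≤n*m u 16) 16u≤s)

    no-zero-sum : ∀ {s s′} → 0 < s → s + s′ ≢ 0
    no-zero-sum {suc s} _ ()

  placed-offset-unique : ∀ {u s s′ y} .{{_ : NonZero u}} → 16 * u ≤ s → 16 * u ≤ s′ →
                         Placed u s y → Placed u s′ y → s ≡ s′
  placed-offset-unique {y = y} _ _ (inj₁ (_ , e)) (inj₁ (_ , e′)) = +-cancelˡ-≡ y _ _ (trans e (sym e′))
  placed-offset-unique _ _ (inj₂ (_ , e)) (inj₂ (_ , e′)) = +-cancelˡ-≡ _ _ _ (trans (sym e) e′)
  placed-offset-unique {u} {s} {s′} _ 16u≤s′ (inj₁ (_ , e)) (inj₂ (_ , e′)) =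
    contradiction (+-cancelˡ-≡ (512 * u) _ 0 (begin
      512 * u + (s′ + s)   ≡⟨ +-assoc (512 * u) s′ s ⟨
      512 * u + s′ + s     ≡⟨ cong (_+ s) e′ ⟨
      _                    ≡⟨ e ⟩
      512 * u              ≡⟨ +-identityʳ _ ⟨
      512 * u + 0          ∎)) (no-zero-sum {s′} {s} (offset-pos 16u≤s′))
    where open ≡-Reasoning
  placed-offset-unique 16u≤s 16u≤s′ p@(inj₂ _) p′@(inj₁ _) =
    sym (placed-offset-unique 16u≤s′ 16u≤s p′ p)

  member-class-unique : ∀ {b b′ u y} .{{_ : NonZero u}} → Member b u y → Member b′ u y → b ≡ b′
  member-class-unique {u = u} {y} (member s 16u≤s _ class p) (member s′ 16u≤s′ _ class′ p′) =
    trans (sym class) (subst (λ o → inB u o y ≡ _) (sym (placed-offset-unique 16u≤s 16u≤s′ p p′)) class′)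

  -- The side of an offset is a function of the offset, so 512u − s and 512u + s′
  -- can only sum to 1024u if s = s′, which would be placed on both sides.
  member-sum-free : ∀ {b b′ u y y′} .{{_ : NonZero u}} →
                    Member b u y → Member b′ u y′ → y + y′ ≢ 1024 * u
  member-sum-free {u = u} {y} {y′} (member s 16u≤s _ _ (inj₁ (_ , e))) (member s′ _ _ _ (inj₁ (_ , e′))) sum =
    no-zero-sum (offset-pos 16u≤s) (+-cancelˡ-≡ (y + y′) _ 0 (begin
      y + y′ + (s + s′)        ≡⟨ solve (y ∷ y′ ∷ s ∷ s′ ∷ []) ⟩
      (y + s) + (y′ + s′)      ≡⟨ cong₂ _+_ e e′ ⟩
      512 * u + 512 * u        ≡⟨ solve (u ∷ []) ⟩
      1024 * u                 ≡⟨ sum ⟨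
      y + y′                   ≡⟨ +-identityʳ _ ⟨
      y + y′ + 0               ∎))
    where open ≡-Reasoning
  member-sum-free {u = u} {y} {y′} (member s 16u≤s _ _ (inj₂ (_ , e))) (member s′ _ _ _ (inj₂ (_ , e′))) sum =
    no-zero-sum (offset-pos 16u≤s) (+-cancelˡ-≡ (1024 * u) _ 0 (begin
      1024 * u + (s + s′)                ≡⟨ solve (u ∷ s ∷ s′ ∷ []) ⟩
      (512 * u + s) + (512 * u + s′)     ≡⟨ cong₂ _+_ e e′ ⟨
      y + y′                             ≡⟨ sum ⟩
      1024 * u                           ≡⟨ +-identityʳ _ ⟨
      1024 * u + 0                       ∎))
    where open ≡-Reasoning
  member-sum-free {u = u} {y} {y′} (member s _ _ _ (inj₁ (below , e))) (member s′ _ _ _ (inj₂ (above′ , e′))) sum =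
    contradiction (trans (sym below) (subst (λ o → above u o ≡ true) (sym s≡s′) above′)) λ ()
    where
    open ≡-Reasoning
    s≡s′ : s ≡ s′
    s≡s′ = +-cancelˡ-≡ (y + 512 * u) _ _ (begin
      y + 512 * u + s          ≡⟨ solve (y ∷ u ∷ s ∷ []) ⟩
      (y + s) + 512 * u        ≡⟨ cong (_+ 512 * u) e ⟩
      512 * u + 512 * u        ≡⟨ solve (u ∷ []) ⟩
      1024 * u                 ≡⟨ sum ⟨
      y + y′                   ≡⟨ cong (y +_) e′ ⟩
      y + (512 * u + s′)       ≡⟨ +-assoc y _ s′ ⟨
      y + 512 * u + s′         ∎)
  member-sum-free {y = y} {y′} m@(member _ _ _ _ (inj₂ _)) m′@(member _ _ _ _ (inj₁ _)) sum =
    member-sum-free m′ m (trans (+-comm y′ y) sum)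

  member-range : ∀ {b u y} .{{_ : NonZero u}} → Member b u y → 256 * u < y × y < 768 * u
  member-range {u = u} {y} (member s _ s<256u _ (inj₁ (_ , e))) =
      +-cancelʳ-< s (256 * u) y (begin-strict
        256 * u + s          <⟨ +-monoʳ-< (256 * u) s<256u ⟩
        256 * u + 256 * u    ≡⟨ solve (u ∷ []) ⟩
        512 * u              ≡⟨ e ⟨
        y + s                ∎)
    , (begin-strict
        y                    ≤⟨ m≤m+n y s ⟩
        y + s                ≡⟨ e ⟩
        512 * u              <⟨ *-monoˡ-< u (<ᵇ⇒< 512 768 _) ⟩
        768 * u              ∎)
    where open ≤-Reasoning
  member-range {u = u} {y} (member s _ s<256u _ (inj₂ (_ , e))) =
      (begin-strict
        256 * u              <⟨ *-monoˡ-< u (<ᵇ⇒< 256 512 _) ⟩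
        512 * u              ≤⟨ m≤m+n _ s ⟩
        512 * u + s          ≡⟨ e ⟨
        y                    ∎)
    , (begin-strict
        y                    ≡⟨ e ⟩
        512 * u + s          <⟨ +-monoʳ-< (512 * u) s<256u ⟩
        512 * u + 256 * u    ≡⟨ solve (u ∷ []) ⟩
        768 * u              ∎)
    where open ≤-Reasoning

  above-tm : ∀ {u s} → s < 48 * u → above u s ≡ tm s
  above-tm s<48u rewrite does-< s<48u = refl

  inB-tm : ∀ {u s y} → s < 48 * u → inB u s y ≡ does (s <? 32 * u)
  inB-tm {u} {s} s<48u with does (s <? 32 * u)
  ... | true  = refl
  ... | false rewrite does-< s<48u = refl

  inB-residues : ∀ {u s y} → 48 * u ≤ s → inB u s y ≡ inB-mod8 y
  inB-residues {u} 48u≤s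
    rewrite does-≥ (≤-trans (scale-≤ 32 48 u) 48u≤s) | does-≥ 48u≤s = refl

  above-48u-64u : ∀ {u s} → 48 * u ≤ s → s < 64 * u → above u s ≡ false
  above-48u-64u 48u≤s s<64u rewrite does-≥ 48u≤s | does-< s<64u = refl

  above-64u-80u : ∀ {u s} → 64 * u ≤ s → s < 80 * u → above u s ≡ true
  above-64u-80u {u} 64u≤s s<80u
    rewrite does-≥ (≤-trans (scale-≤ 48 64 u) 64u≤s) | does-≥ 64u≤s | does-< s<80u = refl

  above-80u : ∀ {u s} → 80 * u ≤ s → above u s ≡ false
  above-80u {u} 80u≤s
    rewrite does-≥ (≤-trans (scale-≤ 48 80 u) 80u≤s)
          | does-≥ (≤-trans (scale-≤ 64 80 u) 80u≤s) | does-≥ 80u≤s = refl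

  tm-member : ∀ {u s y} → 16 * u ≤ s → s < 48 * u →
              (tm s ≡ false × y + s ≡ 512 * u) ⊎ (tm s ≡ true × y ≡ 512 * u + s) →
              Member (does (s <? 32 * u)) u y
  tm-member {u} {s} {y} 16u≤s s<48u p =
    member s 16u≤s (<-≤-trans s<48u (scale-≤ 48 256 u)) (inB-tm {u} {y = y} s<48u) (placed p)
    where
    placed : (tm s ≡ false × y + s ≡ 512 * u) ⊎ (tm s ≡ true × y ≡ 512 * u + s) → Placed u s y
    placed (inj₁ (tm≡ , e)) = inj₁ (trans (above-tm {u} s<48u) tm≡ , e)
    placed (inj₂ (tm≡ , e)) = inj₂ (trans (above-tm {u} s<48u) tm≡ , e)

  -- Where the offsets of [48u, 256u) put their elements; there the class is
  -- decided by the residue mod 8.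
  data Region : Set where
    448-464 576-592 256-432 : Region

  lower upper : Region → ℕ
  lower 448-464 = 448
  lower 576-592 = 576
  lower 256-432 = 256
  upper 448-464 = 464
  upper 576-592 = 592
  upper 256-432 = 432

  InRegion : Region → ℕ → ℕ → Set
  InRegion r u y = lower r * u < y × y < upper r * u

  region-member : ∀ r {u y} → InRegion r u y → Member (inB-mod8 y) u y
  region-member 448-464 {u} {y} (448u<y , y<464u) =
    member s (≤-trans (scale-≤ 16 48 u) 48u≤s) (<-≤-trans s<64u (scale-≤ 64 256 u))
      (inB-residues {u} {y = y} 48u≤s) (inj₁ (above-48u-64u {u} 48u≤s s<64u , y+s≡512u))
    where
    s : ℕ
    s = 512 * u ∸ y
    y+s≡512u : y + s ≡ 512 * u
    y+s≡512u = m+[n∸m]≡n (≤-trans (<⇒≤ y<464u) (scale-≤ 464 512 u))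
    48u≤s : 48 * u ≤ s
    48u≤s = <⇒≤ (complement-< 464 48 u y+s≡512u y<464u)
    s<64u : s < 64 * u
    s<64u = complement-> 448 64 u y+s≡512u 448u<y
  region-member 576-592 {u} {y} (576u<y , y<592u) =
    member s (≤-trans (scale-≤ 16 64 u) 64u≤s) (<-≤-trans s<80u (scale-≤ 80 256 u))
      (inB-residues {u} {y = y} (≤-trans (scale-≤ 48 64 u) 64u≤s))
      (inj₂ (above-64u-80u {u} 64u≤s s<80u , sym 512u+s≡y))
    where
    s : ℕ
    s = y ∸ 512 * u
    512u+s≡y : 512 * u + s ≡ y
    512u+s≡y = m+[n∸m]≡n (≤-trans (scale-≤ 512 576 u) (<⇒≤ 576u<y))
    64u≤s : 64 * u ≤ s
    64u≤s = <⇒≤ (+-cancelˡ-< (512 * u) _ _ (subst₂ _<_ (*-distribʳ-+ u 512 64) (sym 512u+s≡y) 576u<y))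
    s<80u : s < 80 * u
    s<80u = +-cancelˡ-< (512 * u) _ _ (subst₂ _<_ (sym 512u+s≡y) (*-distribʳ-+ u 512 80) y<592u)
  region-member 256-432 {u} {y} (256u<y , y<432u) =
    member s (≤-trans (scale-≤ 16 80 u) 80u≤s) (complement-> 256 256 u y+s≡512u 256u<y)
      (inB-residues {u} {y = y} (≤-trans (scale-≤ 48 80 u) 80u≤s)) (inj₁ (above-80u {u} 80u≤s , y+s≡512u))
    where
    s : ℕ
    s = 512 * u ∸ y
    y+s≡512u : y + s ≡ 512 * u
    y+s≡512u = m+[n∸m]≡n (≤-trans (<⇒≤ y<432u) (scale-≤ 432 512 u))
    80u≤s : 80 * u ≤ s
    80u≤s = <⇒≤ (complement-< 432 80 u y+s≡512u y<432u)

module Representations where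

  open import Data.Bool.Base using (Bool; true; false; not; _xor_)
  open import Data.Bool.Properties using (xor-same; xor-identityʳ; xor-comm) renaming (_≟_ to _≟ᵇ_)
  open import Data.Fin.Base using (Fin; toℕ)
  open import Data.Fin.Properties using (toℕ<n; toℕ-injective)
  open import Data.Nat.Base
  open import Data.Nat.Properties
  open import Data.Nat.DivMod using (/-monoˡ-≤; m*n/n≡m; [m+kn]%n≡m%n; m<n⇒m%n≡m; %-distribˡ-+; m%n<n)
  open import Data.Nat.Tactic.RingSolver using (solve-∀; solve)
  open import Data.List.Base using (List; _∷_; [])
  open import Data.List.Relation.Unary.All as All using (All)
  open import Data.Product.Base using (Σ; _×_; _,_; proj₁; proj₂)
  open import Data.Sum.Base using (_⊎_; inj₁; inj₂)
  open import Function.Definitions using (Injective)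
  open import Relation.Binary.PropositionalEquality
  open import Relation.Nullary.Decidable using (Dec; does; yes; no; _×-dec_; _→-dec_; from-yes)
  open import Relation.Nullary.Negation using (contradiction)
  open import Defs using (h)
  open Preliminaries
  open ThueMorse
  open Levels

  InBase : Bool → ℕ → Set
  InBase b y = Σ ℕ λ e → Member b (4 ^ e) y

  Pair : (ℕ → Set) → ℕ → ℕ × ℕ → Set
  Pair P n (y , y′) = P y × P y′ × y + y′ ≡ n × 1 ≤ y × y ≤ y′ × y′ ≤ 100 * y

  Pairs : (ℕ → Set) → ℕ → ℕ → Set
  Pairs P n K = Σ (Fin K → ℕ × ℕ) λ f → Injective _≡_ _≡_ f × (∀ i → Pair P n (f i))

  EnoughPairs : Bool → ℕ → Set
  EnoughPairs b n = Σ ℕ λ K → Pairs (InBase b) n K × h n ≤ K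

  h≤ : ∀ {n K} → n ≤ K * 100000000 → h n ≤ K
  h≤ {n} {K} n≤K10⁸ = ≤-trans (/-monoˡ-≤ 100000000 n≤K10⁸) (≤-reflexive (m*n/n≡m K 100000000))

  h≤-from-ratio : ∀ {n u D} → n ≤ 1025 * u → 2 * u ≤ 3 * D → h n ≤ D
  h≤-from-ratio {n} {u} {D} n≤1025u 2u≤3D = h≤ (begin
    n                       ≤⟨ *-cancelˡ-≤ 3 (begin
                                 3 * n              ≤⟨ *-monoʳ-≤ 3 n≤1025u ⟩
                                 3 * (1025 * u)     ≤⟨ *-monoʳ-≤ 3 (scale-≤ 1025 1026 u) ⟩
                                 3 * (1026 * u)     ≡⟨ solve (u ∷ []) ⟩
                                 1539 * (2 * u)     ≤⟨ *-monoʳ-≤ 1539 2u≤3D ⟩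
                                 1539 * (3 * D)     ≡⟨ solve (D ∷ []) ⟩
                                 3 * (1539 * D)     ∎) ⟩
    1539 * D                ≤⟨ scale-≤ 1539 100000000 D ⟩
    100000000 * D           ≡⟨ *-comm 100000000 D ⟩
    D * 100000000           ∎)
    where open ≤-Reasoning

  module ThueMorsePairs (e u : ℕ) (u≡4^e : u ≡ 4 ^ e) where

    instance
      u≢0 : NonZero u
      u≢0 = subst NonZero (sym u≡4^e) (m^n≢0 4 e)

    4^e≡2^2e : u ≡ 2 ^ (2 * e)
    4^e≡2^2e = trans u≡4^e (^-*-assoc 2 2 e)

    tm-concat-8u : ∀ c {w} → w < 8 * u → tm (c * (8 * u) + w) ≡ tm c xor tm w
    tm-concat-8u c {w} w<8u =
      subst (λ M → tm (c * M + w) ≡ tm c xor tm w) (sym 8u≡2^) (tm-concat (3 + 2 * e) c (subst (w <_) 8u≡2^ w<8u))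
      where
      8u≡2^ : 8 * u ≡ 2 ^ (3 + 2 * e)
      8u≡2^ = trans (cong (8 *_) 4^e≡2^2e) (sym (^-distribˡ-+-* 2 3 (2 * e)))

    mismatches-lower : ∀ t → 1 ≤ t → t ≤ u → 2 * u ≤ 3 * mismatches (4 * u) t
    mismatches-lower t 1≤t t≤u = +-cancelʳ-≤ (2 * u) _ _ (begin
      2 * u + 2 * u                                ≡⟨ solve (u ∷ []) ⟩
      4 * u                                        ≡⟨ 4u≡2^ ⟩
      2 ^ (2 + 2 * e)                              ≤⟨ proj₁ (proj₂ (mismatchBounds (2 + 2 * e)) t 1≤t) ⟩
      3 * mismatches (2 ^ (2 + 2 * e)) t + 2 * t   ≡⟨ cong (λ R → 3 * mismatches R t + 2 * t) 4u≡2^ ⟨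
      3 * mismatches (4 * u) t + 2 * t             ≤⟨ +-monoʳ-≤ (3 * mismatches (4 * u) t) (*-monoʳ-≤ 2 t≤u) ⟩
      3 * mismatches (4 * u) t + 2 * u             ∎)
      where
      open ≤-Reasoning
      4u≡2^ : 4 * u ≡ 2 ^ (2 + 2 * e)
      4u≡2^ = trans (cong (4 *_) 4^e≡2^2e) (sym (^-distribˡ-+-* 2 2 (2 * e)))

    -- A number with Thue–Morse bit x; offsets in its block of 8u lie below 32u
    -- (class B) if b = true and in [32u, 48u) (class C) otherwise.
    block : Bool → Bool → ℕ
    block true  true  = 2
    block true  false = 3
    block false true  = 4
    block false false = 5

    tm-block : ∀ b x → tm (block b x) ≡ x
    tm-block true  true  = refl
    tm-block true  false = refl
    tm-block false true  = refl
    tm-block false false = refl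

    block-class : ∀ b x {o} → block b x * (8 * u) ≤ o → o < (8 * block b x + 5) * u → does (o <? 32 * u) ≡ b
    block-class true  true  _ o< = does-< (<-≤-trans o< (scale-≤ 21 32 u))
    block-class true  false _ o< = does-< (<-≤-trans o< (scale-≤ 29 32 u))
    block-class false true  ≤o _ = does-≥ (≤-trans (≤-reflexive (*-assoc 4 8 u)) ≤o)
    block-class false false ≤o _ =
      does-≥ (≤-trans (scale-≤ 32 40 u) (≤-trans (≤-reflexive (*-assoc 5 8 u)) ≤o))

    block-end≤48 : ∀ b x → 8 * block b x + 5 ≤ 48
    block-end≤48 true  true  = ≤ᵇ⇒≤ 21 48 _
    block-end≤48 true  false = ≤ᵇ⇒≤ 29 48 _
    block-end≤48 false true  = ≤ᵇ⇒≤ 37 48 _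
    block-end≤48 false false = ≤ᵇ⇒≤ 45 48 _

    block≥2 : ∀ b x → 2 ≤ block b x
    block≥2 true  true  = ≤-refl
    block≥2 true  false = ≤ᵇ⇒≤ 2 3 _
    block≥2 false true  = ≤ᵇ⇒≤ 2 4 _
    block≥2 false false = ≤ᵇ⇒≤ 2 5 _

    block-offset< : ∀ c {w t} → w < 4 * u → t ≤ u → c * (8 * u) + w + t < (8 * c + 5) * u
    block-offset< c {w} {t} w<4u t≤u = begin-strict
      c * (8 * u) + w + t       ≡⟨ +-assoc (c * (8 * u)) w t ⟩
      c * (8 * u) + (w + t)     <⟨ +-monoʳ-< (c * (8 * u)) (+-mono-<-≤ w<4u t≤u) ⟩
      c * (8 * u) + (4 * u + u) ≡⟨ solve (c ∷ u ∷ []) ⟩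
      (8 * c + 5) * u           ∎
      where open ≤-Reasoning

    TMOffset : Bool → ℕ → Set
    TMOffset b o = 16 * u ≤ o × o < 48 * u × does (o <? 32 * u) ≡ b

    tm-pair : ∀ {b n s₀ s₁} → TMOffset b s₀ → TMOffset b s₁ → tm s₀ ≡ false × tm s₁ ≡ true →
              n + s₀ ≡ 1024 * u + s₁ → Pair (InBase b) n (512 * u ∸ s₀ , 512 * u + s₁)
    tm-pair {b} {n} {s₀} {s₁} (16u≤s₀ , s₀<48u , class₀) (16u≤s₁ , s₁<48u , class₁) (tm₀ , tm₁) balanced =
        (e , subst₂ (λ c v → Member c v y) class₀ u≡4^e
               (tm-member 16u≤s₀ s₀<48u (inj₁ (tm₀ , y+s₀≡512u))))
      , (e , subst₂ (λ c v → Member c v y′) class₁ u≡4^e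
               (tm-member 16u≤s₁ s₁<48u (inj₂ (tm₁ , refl))))
      , +-cancelʳ-≡ s₀ _ _ (begin-equality
          y + y′ + s₀              ≡⟨ regroup y (512 * u) s₁ s₀ ⟩
          (y + s₀) + 512 * u + s₁  ≡⟨ cong (λ m → m + 512 * u + s₁) y+s₀≡512u ⟩
          512 * u + 512 * u + s₁   ≡⟨ solve (u ∷ s₁ ∷ []) ⟩
          1024 * u + s₁            ≡⟨ balanced ⟨
          n + s₀                   ∎)
      , ≤-trans (s≤s z≤n) 464u<y
      , ≤-trans (m∸n≤m (512 * u) s₀) (m≤m+n (512 * u) s₁)
      , (begin
          y′                       ≤⟨ +-monoʳ-≤ (512 * u) (<⇒≤ s₁<48u) ⟩
          512 * u + 48 * u         ≡⟨ solve (u ∷ []) ⟩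
          560 * u                  ≤⟨ scale-≤ 560 46400 u ⟩
          46400 * u                ≡⟨ *-assoc 100 464 u ⟩
          100 * (464 * u)          ≤⟨ *-monoʳ-≤ 100 (<⇒≤ 464u<y) ⟩
          100 * y                  ∎)
      where
      open ≤-Reasoning
      y y′ : ℕ
      y  = 512 * u ∸ s₀
      y′ = 512 * u + s₁
      y+s₀≡512u : y + s₀ ≡ 512 * u
      y+s₀≡512u = m∸n+n≡m (<⇒≤ (<-≤-trans s₀<48u (scale-≤ 48 512 u)))
      regroup : ∀ a b c d → a + (b + c) + d ≡ (a + d) + b + c
      regroup = solve-∀
      464u<y : 464 * u < y
      464u<y = complement-< 48 464 u (trans (+-comm s₀ y) y+s₀≡512u) s₀<48u

    instance
      8u≢0 : NonZero (8 * u)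
      8u≢0 = m*n≢0 8 u

    block-offset-digit : ∀ c {w} → w < 8 * u → (c * (8 * u) + w) % (8 * u) ≡ w
    block-offset-digit c {w} w<8u = begin
      (c * (8 * u) + w) % (8 * u)   ≡⟨ cong (_% (8 * u)) (+-comm _ w) ⟩
      (w + c * (8 * u)) % (8 * u)   ≡⟨ [m+kn]%n≡m%n w c (8 * u) ⟩
      w % (8 * u)                   ≡⟨ m<n⇒m%n≡m w<8u ⟩
      w                             ∎
      where open ≡-Reasoning

    -- (s₀ , s₁) = (s , s + t) or (s + t , s), whichever has tm(s₀) = 0 and tm(s₁) = 1
    offsets : Bool → ℕ → ℕ → ℕ × ℕ
    offsets false s t = s , s + t
    offsets true  s t = s + t , s

    offsets-both : ∀ σ {s t} (P : ℕ → Set) → P s → P (s + t) →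
                   P (proj₁ (offsets σ s t)) × P (proj₂ (offsets σ s t))
    offsets-both false P p q = p , q
    offsets-both true  P p q = q , p

    offsets-tm : ∀ σ {s t} → tm s ≡ σ → tm (s + t) ≡ not σ →
                 tm (proj₁ (offsets σ s t)) ≡ false × tm (proj₂ (offsets σ s t)) ≡ true
    offsets-tm false p q = p , q
    offsets-tm true  p q = q , p

    offsets-injective : ∀ σ {s s′ t} → proj₂ (offsets σ s t) ≡ proj₂ (offsets σ s′ t) → s ≡ s′
    offsets-injective false {t = t} e = +-cancelʳ-≡ t _ _ e
    offsets-injective true          e = e

    -- Each w < 4u with tm(w) ≠ tm(w + t) is moved into the block of 8u whose
    -- Thue–Morse bit makes tm(s) = σ for s = block · 8u + w; then tm(s + t) = not σ.
    tm-pairs : ∀ b σ {t n} → t ≤ u → (∀ s → n + proj₁ (offsets σ s t) ≡ 1024 * u + proj₂ (offsets σ s t)) →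
               Pairs (InBase b) n (mismatches (4 * u) t)
    tm-pairs b σ {t} {n} t≤u balanced = pair , pair-injective , pair-ok
      where
      mismatched : Enumeration (mismatch t) (4 * u) (mismatches (4 * u) t)
      mismatched = count-enumerate (mismatch t) (4 * u) ≤-refl
      w : Fin (mismatches (4 * u) t) → ℕ
      w = proj₁ mismatched
      w<4u : ∀ i → w i < 4 * u
      w<4u i = proj₁ (proj₂ (proj₂ mismatched) i)
      w<8u : ∀ i → w i < 8 * u
      w<8u i = <-≤-trans (w<4u i) (scale-≤ 4 8 u)
      w+t<8u : ∀ i → w i + t < 8 * u
      w+t<8u i = <-≤-trans (+-mono-<-≤ (w<4u i) t≤u) (≤-trans (≤-reflexive (+-comm (4 * u) u)) (scale-≤ 5 8 u))
      c : Fin (mismatches (4 * u) t) → ℕ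
      c i = block b (tm (w i) xor σ)
      s : Fin (mismatches (4 * u) t) → ℕ
      s i = c i * (8 * u) + w i
      s₀ s₁ : Fin (mismatches (4 * u) t) → ℕ
      s₀ i = proj₁ (offsets σ (s i) t)
      s₁ i = proj₂ (offsets σ (s i) t)
      pair : Fin (mismatches (4 * u) t) → ℕ × ℕ
      pair i = 512 * u ∸ s₀ i , 512 * u + s₁ i

      tm-s : ∀ i → tm (s i) ≡ σ
      tm-s i = begin
        tm (s i)                             ≡⟨ tm-concat-8u (c i) (w<8u i) ⟩
        tm (c i) xor tm (w i)                ≡⟨ cong (_xor tm (w i)) (tm-block b _) ⟩
        (tm (w i) xor σ) xor tm (w i)        ≡⟨ xor-shuffle (tm (w i)) σ (tm (w i)) ⟩
        σ xor (tm (w i) xor tm (w i))        ≡⟨ cong (σ xor_) (xor-same (tm (w i))) ⟩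
        σ xor false                          ≡⟨ xor-identityʳ σ ⟩
        σ                                    ∎
        where open ≡-Reasoning
      tm-s+t : ∀ i → tm (s i + t) ≡ not σ
      tm-s+t i = begin
        tm (s i + t)                         ≡⟨ cong tm (+-assoc (c i * (8 * u)) (w i) t) ⟩
        tm (c i * (8 * u) + (w i + t))       ≡⟨ tm-concat-8u (c i) (w+t<8u i) ⟩
        tm (c i) xor tm (w i + t)            ≡⟨ cong (_xor tm (w i + t)) (tm-block b _) ⟩
        (tm (w i) xor σ) xor tm (w i + t)    ≡⟨ xor-shuffle (tm (w i)) σ (tm (w i + t)) ⟩
        σ xor mismatch t (w i)               ≡⟨ cong (σ xor_) (proj₂ (proj₂ (proj₂ mismatched) i)) ⟩
        σ xor true                           ≡⟨ xor-comm σ true ⟩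
        not σ                                ∎
        where open ≡-Reasoning

      s-offsets : ∀ i → TMOffset b (s i) × TMOffset b (s i + t)
      s-offsets i = offset (m≤m+n _ (w i)) (≤-<-trans (m≤m+n (s i) t) end)
                  , offset (≤-trans (m≤m+n _ (w i)) (m≤m+n (s i) t)) end
        where
        x : Bool
        x = tm (w i) xor σ
        end : s i + t < (8 * c i + 5) * u
        end = block-offset< (c i) (w<4u i) t≤u
        16u≤block : 16 * u ≤ c i * (8 * u)
        16u≤block = ≤-trans (≤-reflexive (*-assoc 2 8 u)) (*-monoˡ-≤ (8 * u) (block≥2 b x))
        offset : ∀ {o} → c i * (8 * u) ≤ o → o < (8 * c i + 5) * u → TMOffset b o
        offset ≤o o< =
          ≤-trans 16u≤block ≤o , <-≤-trans o< (*-monoˡ-≤ u (block-end≤48 b x)) , block-class b x ≤o o<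

      pair-ok : ∀ i → Pair (InBase b) n (pair i)
      pair-ok i = tm-pair (proj₁ ends) (proj₂ ends) (offsets-tm σ (tm-s i) (tm-s+t i)) (balanced (s i))
        where
        ends : TMOffset b (s₀ i) × TMOffset b (s₁ i)
        ends = offsets-both σ (TMOffset b) (proj₁ (s-offsets i)) (proj₂ (s-offsets i))

      pair-injective : Injective _≡_ _≡_ pair
      pair-injective {i} {j} e = proj₁ (proj₂ mismatched) (begin
        w i                           ≡⟨ block-offset-digit (c i) (w<8u i) ⟨
        s i % (8 * u)                 ≡⟨ cong (_% (8 * u)) (offsets-injective σ (+-cancelˡ-≡ (512 * u) _ _ (cong proj₂ e))) ⟩
        s j % (8 * u)                 ≡⟨ block-offset-digit (c j) (w<8u j) ⟩
        w j                           ∎)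
        where open ≡-Reasoning

    h≤mismatches : ∀ {t n} → 1 ≤ t → t ≤ u → n ≤ 1025 * u → h n ≤ mismatches (4 * u) t
    h≤mismatches 1≤t t≤u n≤1025u = h≤-from-ratio {u = u} n≤1025u (mismatches-lower _ 1≤t t≤u)

  -- For each residue ρ of n and each class, a residue of x such that x and n − x
  -- both lie in that class.
  partner : Bool → ℕ → ℕ
  partner true  0 = 0
  partner true  1 = 0
  partner true  2 = 1
  partner true  3 = 0
  partner true  4 = 0
  partner true  5 = 1
  partner true  6 = 3
  partner true  7 = 3
  partner false 0 = 2
  partner false 1 = 2
  partner false 2 = 5
  partner false 3 = 5
  partner false 4 = 2
  partner false 5 = 6
  partner false 6 = 7
  partner false 7 = 2
  partner _     _ = 0

  PartnerWorks : Bool → ℕ → Set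
  PartnerWorks b ρ = partner b ρ < 8 × inB-residue (partner b ρ) ≡ b
                   × (∀ {r} → r < 8 → (partner b ρ + r) % 8 ≡ ρ → inB-residue r ≡ b)

  partnerWorks? : ∀ b ρ → Dec (PartnerWorks b ρ)
  partnerWorks? b ρ = (partner b ρ <? 8) ×-dec (inB-residue (partner b ρ) ≟ᵇ b)
                    ×-dec allUpTo? (λ r → ((partner b ρ + r) % 8 ≟ ρ) →-dec (inB-residue r ≟ᵇ b)) 8

  partner-works : ∀ b {ρ} → ρ < 8 → PartnerWorks b ρ
  partner-works true  = from-yes (allUpTo? (partnerWorks? true) 8)
  partner-works false = from-yes (allUpTo? (partnerWorks? false) 8)

  residue-pair : ∀ b n {x} → x % 8 ≡ partner b (n % 8) → x ≤ n → inB-mod8 x ≡ b × inB-mod8 (n ∸ x) ≡ b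
  residue-pair b n {x} x%8 x≤n =
      trans (cong inB-residue x%8) (proj₁ (proj₂ works))
    , proj₂ (proj₂ works) (m%n<n (n ∸ x) 8) (begin
        (partner b (n % 8) + (n ∸ x) % 8) % 8   ≡⟨ cong (λ r → (r + (n ∸ x) % 8) % 8) x%8 ⟨
        (x % 8 + (n ∸ x) % 8) % 8              ≡⟨ %-distribˡ-+ x (n ∸ x) 8 ⟨
        (x + (n ∸ x)) % 8                      ≡⟨ cong (_% 8) (m+[n∸m]≡n x≤n) ⟩
        n % 8                                  ∎)
    where
    open ≡-Reasoning
    works : PartnerWorks b (n % 8)
    works = partner-works b (m%n<n n 8)

  -- In units V = 16 · 4^f: for N₁V ≤ n ≤ N₂V, x runs through the residue class
  -- partner b (n mod 8) in (AV, (A + ℓ)V), inside region rx of the level with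
  -- unit 4^jx V, and n − x lies in region ry of the level with unit 4^jy V;
  -- x≤y says which of the two summands is the smaller one.
  record SolidCase : Set where
    constructor solid
    field
      N₁ N₂ A ℓ jx jy : ℕ
      rx ry : Region
      x≤y : Bool

  Ordered : Bool → (N₁ N₂ A ℓ : ℕ) → Set
  Ordered true  N₁ N₂ A ℓ = 2 * (A + ℓ) ≤ N₁ × N₂ ≤ 100 * A
  Ordered false N₁ N₂ A ℓ = N₂ ≤ 2 * A × 101 * (A + ℓ) ≤ 100 * N₁

  ordered? : ∀ o N₁ N₂ A ℓ → Dec (Ordered o N₁ N₂ A ℓ)
  ordered? true  N₁ N₂ A ℓ = (2 * (A + ℓ) ≤? N₁) ×-dec (N₂ ≤? 100 * A)
  ordered? false N₁ N₂ A ℓ = (N₂ ≤? 2 * A) ×-dec (101 * (A + ℓ) ≤? 100 * N₁)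

  Valid : SolidCase → Set
  Valid (solid N₁ N₂ A ℓ jx jy rx ry o) =
      lower rx * 4 ^ jx ≤ A × A + ℓ ≤ upper rx * 4 ^ jx
    × lower ry * 4 ^ jy + (A + ℓ) ≤ N₁ × N₂ ≤ upper ry * 4 ^ jy + A
    × 1 ≤ ℓ × 16 * N₂ ≤ 100000000 × Ordered o N₁ N₂ A ℓ

  valid? : ∀ c → Dec (Valid c)
  valid? (solid N₁ N₂ A ℓ jx jy rx ry o) =
        (lower rx * 4 ^ jx ≤? A) ×-dec (A + ℓ ≤? upper rx * 4 ^ jx)
    ×-dec (lower ry * 4 ^ jy + (A + ℓ) ≤? N₁) ×-dec (N₂ ≤? upper ry * 4 ^ jy + A)
    ×-dec (1 ≤? ℓ) ×-dec (16 * N₂ ≤? 100000000) ×-dec ordered? o N₁ N₂ A ℓ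

  module SolidPairs (f Z : ℕ) (Z≡4^f : Z ≡ 4 ^ f) (b : Bool)
                    (N₁ N₂ A ℓ jx jy : ℕ) (rx ry : Region) (x≤y : Bool)
                    (valid : Valid (solid N₁ N₂ A ℓ jx jy rx ry x≤y))
                    {n : ℕ} (N₁V≤n : N₁ * (16 * Z) ≤ n) (n≤N₂V : n ≤ N₂ * (16 * Z)) where

    instance
      Z≢0 : NonZero Z
      Z≢0 = subst NonZero (sym Z≡4^f) (m^n≢0 4 f)

    x-lower : lower rx * 4 ^ jx ≤ A
    x-lower = proj₁ valid
    x-upper : A + ℓ ≤ upper rx * 4 ^ jx
    x-upper = proj₁ (proj₂ valid)
    y-lower : lower ry * 4 ^ jy + (A + ℓ) ≤ N₁
    y-lower = proj₁ (proj₂ (proj₂ valid))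
    y-upper : N₂ ≤ upper ry * 4 ^ jy + A
    y-upper = proj₁ (proj₂ (proj₂ (proj₂ valid)))
    1≤ℓ : 1 ≤ ℓ
    1≤ℓ = proj₁ (proj₂ (proj₂ (proj₂ (proj₂ valid))))
    16N₂≤10⁸ : 16 * N₂ ≤ 100000000
    16N₂≤10⁸ = proj₁ (proj₂ (proj₂ (proj₂ (proj₂ (proj₂ valid)))))
    ordered : Ordered x≤y N₁ N₂ A ℓ
    ordered = proj₂ (proj₂ (proj₂ (proj₂ (proj₂ (proj₂ valid)))))

    r : ℕ
    r = partner b (n % 8)

    x : Fin (ℓ * Z) → ℕ
    x m = r + (2 * A * Z + suc (toℕ m)) * 8

    x%8 : ∀ m → x m % 8 ≡ r
    x%8 m = trans ([m+kn]%n≡m%n r (2 * A * Z + suc (toℕ m)) 8) (m<n⇒m%n≡m (proj₁ (partner-works b (m%n<n n 8))))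

    AV<x : ∀ m → A * (16 * Z) < x m
    AV<x m = begin-strict
      A * (16 * Z)                         ≡⟨ solve (A ∷ Z ∷ []) ⟩
      2 * A * Z * 8                        <⟨ *-monoˡ-< 8 (m<m+n (2 * A * Z) (s≤s z≤n)) ⟩
      (2 * A * Z + suc (toℕ m)) * 8        ≤⟨ m≤n+m _ r ⟩
      x m                                  ∎
      where open ≤-Reasoning

    x<[A+ℓ]V : ∀ m → x m < (A + ℓ) * (16 * Z)
    x<[A+ℓ]V m = begin-strict
      r + (2 * A * Z + suc (toℕ m)) * 8        <⟨ +-monoˡ-< _ (proj₁ (partner-works b (m%n<n n 8))) ⟩
      8 + (2 * A * Z + suc (toℕ m)) * 8        ≤⟨ +-monoʳ-≤ 8 (*-monoˡ-≤ 8 (+-monoʳ-≤ (2 * A * Z) (toℕ<n m))) ⟩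
      8 * 1 + (2 * A * Z + ℓ * Z) * 8          ≤⟨ +-monoˡ-≤ ((2 * A * Z + ℓ * Z) * 8) (*-monoʳ-≤ 8 1≤ℓZ) ⟩
      8 * (ℓ * Z) + (2 * A * Z + ℓ * Z) * 8    ≡⟨ solve (A ∷ ℓ ∷ Z ∷ []) ⟩
      (A + ℓ) * (16 * Z)                       ∎
      where
      open ≤-Reasoning
      1≤ℓZ : 1 ≤ ℓ * Z
      1≤ℓZ = *-mono-≤ 1≤ℓ (>-nonZero⁻¹ Z)

    x-injective : ∀ {i j} → x i ≡ x j → i ≡ j
    x-injective e =
      toℕ-injective (suc-injective (+-cancelˡ-≡ (2 * A * Z) _ _ (*-cancelʳ-≡ _ _ 8 (+-cancelˡ-≡ r _ _ e))))

    x≤n : ∀ m → x m ≤ n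
    x≤n m = ≤-trans (<⇒≤ (x<[A+ℓ]V m)) (≤-trans (*-monoˡ-≤ (16 * Z) A+ℓ≤N₁) N₁V≤n)
      where
      A+ℓ≤N₁ : A + ℓ ≤ N₁
      A+ℓ≤N₁ = ≤-trans (m≤n+m (A + ℓ) (lower ry * 4 ^ jy)) y-lower

    y : Fin (ℓ * Z) → ℕ
    y m = n ∸ x m

    x+y≡n : ∀ m → x m + y m ≡ n
    x+y≡n m = m+[n∸m]≡n (x≤n m)

    y-injective : ∀ {i j} → y i ≡ y j → i ≡ j
    y-injective {i} {j} e =
      x-injective (+-cancelʳ-≡ (y i) _ _ (trans (x+y≡n i) (trans (sym (x+y≡n j)) (cong (x j +_) (sym e)))))

    in-base : ∀ j rg {z} → lower rg * 4 ^ j * (16 * Z) < z → z < upper rg * 4 ^ j * (16 * Z) →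
              inB-mod8 z ≡ b → InBase b z
    in-base j rg {z} lo hi class = j + (2 + f) , subst₂ (λ c u → Member c u z) class level
      (region-member rg (subst (_< z) (*-assoc (lower rg) _ _) lo , subst (z <_) (*-assoc (upper rg) _ _) hi))
      where
      level : 4 ^ j * (16 * Z) ≡ 4 ^ (j + (2 + f))
      level = trans (cong (λ v → 4 ^ j * (16 * v)) Z≡4^f)
                    (trans (cong (4 ^ j *_) (*-assoc 4 4 (4 ^ f))) (sym (^-distribˡ-+-* 4 j (2 + f))))

    classes : ∀ m → inB-mod8 (x m) ≡ b × inB-mod8 (y m) ≡ b
    classes m = residue-pair b n (x%8 m) (x≤n m)

    x∈B : ∀ m → InBase b (x m)
    x∈B m = in-base jx rx (≤-<-trans (*-monoˡ-≤ (16 * Z) x-lower) (AV<x m))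
                          (<-≤-trans (x<[A+ℓ]V m) (*-monoˡ-≤ (16 * Z) x-upper)) (proj₁ (classes m))

    y-above : ∀ m → lower ry * 4 ^ jy * (16 * Z) < y m
    y-above m = +-cancelˡ-< ((A + ℓ) * V) _ _ (begin-strict
      (A + ℓ) * V + lower ry * 4 ^ jy * V       ≡⟨ +-comm ((A + ℓ) * V) _ ⟩
      lower ry * 4 ^ jy * V + (A + ℓ) * V       ≡⟨ *-distribʳ-+ V (lower ry * 4 ^ jy) (A + ℓ) ⟨
      (lower ry * 4 ^ jy + (A + ℓ)) * V         ≤⟨ *-monoˡ-≤ V y-lower ⟩
      N₁ * V                                    ≤⟨ N₁V≤n ⟩
      n                                         ≡⟨ x+y≡n m ⟨
      x m + y m                                 <⟨ +-monoˡ-< (y m) (x<[A+ℓ]V m) ⟩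
      (A + ℓ) * V + y m                         ∎)
      where
      open ≤-Reasoning
      V : ℕ
      V = 16 * Z

    y-below : ∀ m → y m < upper ry * 4 ^ jy * (16 * Z)
    y-below m = +-cancelʳ-< (x m) _ _ (begin-strict
      y m + x m                                 ≡⟨ +-comm (y m) (x m) ⟩
      x m + y m                                 ≡⟨ x+y≡n m ⟩
      n                                         ≤⟨ n≤N₂V ⟩
      N₂ * V                                    ≤⟨ *-monoˡ-≤ V y-upper ⟩
      (upper ry * 4 ^ jy + A) * V               ≡⟨ *-distribʳ-+ V (upper ry * 4 ^ jy) A ⟩
      upper ry * 4 ^ jy * V + A * V             <⟨ +-monoʳ-< _ (AV<x m) ⟩
      upper ry * 4 ^ jy * V + x m               ∎)
      where
      open ≤-Reasoning
      V : ℕ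
      V = 16 * Z

    y∈B : ∀ m → InBase b (y m)
    y∈B m = in-base jy ry (y-above m) (y-below m) (proj₂ (classes m))

    ordered-pairs : ∀ o → Ordered o N₁ N₂ A ℓ → Pairs (InBase b) n (ℓ * Z)
    ordered-pairs true (2[A+ℓ]≤N₁ , N₂≤100A) =
        (λ m → x m , y m) , (λ e → x-injective (cong proj₁ e))
      , λ m → x∈B m , y∈B m , x+y≡n m , ≤-trans (s≤s z≤n) (AV<x m) , <⇒≤ (x<y m) , y≤100x m
      where
      open ≤-Reasoning
      V : ℕ
      V = 16 * Z
      x<y : ∀ m → x m < y m
      x<y m = +-cancelˡ-< (x m) _ _ (begin-strict
        x m + x m                   <⟨ +-mono-< (x<[A+ℓ]V m) (x<[A+ℓ]V m) ⟩
        (A + ℓ) * V + (A + ℓ) * V   ≡⟨ trans (*-assoc 2 (A + ℓ) V) (2*m≡m+m ((A + ℓ) * V)) ⟨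
        2 * (A + ℓ) * V             ≤⟨ *-monoˡ-≤ V 2[A+ℓ]≤N₁ ⟩
        N₁ * V                      ≤⟨ N₁V≤n ⟩
        n                           ≡⟨ x+y≡n m ⟨
        x m + y m                   ∎)
      y≤100x : ∀ m → y m ≤ 100 * x m
      y≤100x m = begin
        y m                         ≤⟨ m≤n+m (y m) (x m) ⟩
        x m + y m                   ≡⟨ x+y≡n m ⟩
        n                           ≤⟨ n≤N₂V ⟩
        N₂ * V                      ≤⟨ *-monoˡ-≤ V N₂≤100A ⟩
        100 * A * V                 ≡⟨ *-assoc 100 A V ⟩
        100 * (A * V)               ≤⟨ *-monoʳ-≤ 100 (<⇒≤ (AV<x m)) ⟩
        100 * x m                   ∎
    ordered-pairs false (N₂≤2A , 101[A+ℓ]≤100N₁) =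
        (λ m → y m , x m) , (λ e → y-injective (cong proj₁ e))
      , λ m → y∈B m , x∈B m , trans (+-comm (y m) (x m)) (x+y≡n m) , 1≤y m , <⇒≤ (y<x m) , x≤100y m
      where
      open ≤-Reasoning
      V : ℕ
      V = 16 * Z
      y<x : ∀ m → y m < x m
      y<x m = +-cancelʳ-< (x m) _ _ (begin-strict
        y m + x m                   ≡⟨ +-comm (y m) (x m) ⟩
        x m + y m                   ≡⟨ x+y≡n m ⟩
        n                           ≤⟨ n≤N₂V ⟩
        N₂ * V                      ≤⟨ *-monoˡ-≤ V N₂≤2A ⟩
        2 * A * V                   ≡⟨ trans (*-assoc 2 A V) (2*m≡m+m (A * V)) ⟩
        A * V + A * V               <⟨ +-mono-< (AV<x m) (AV<x m) ⟩
        x m + x m                   ∎)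
      x≤100y : ∀ m → x m ≤ 100 * y m
      x≤100y m = <⇒≤ (+-cancelˡ-< (100 * x m) _ _ (begin-strict
        100 * x m + x m             ≡⟨ +-comm (100 * x m) (x m) ⟩
        101 * x m                   <⟨ *-monoʳ-< 101 (x<[A+ℓ]V m) ⟩
        101 * ((A + ℓ) * V)         ≡⟨ *-assoc 101 (A + ℓ) V ⟨
        101 * (A + ℓ) * V           ≤⟨ *-monoˡ-≤ V 101[A+ℓ]≤100N₁ ⟩
        100 * N₁ * V                ≡⟨ *-assoc 100 N₁ V ⟩
        100 * (N₁ * V)              ≤⟨ *-monoʳ-≤ 100 N₁V≤n ⟩
        100 * n                     ≡⟨ cong (100 *_) (x+y≡n m) ⟨
        100 * (x m + y m)           ≡⟨ *-distribˡ-+ 100 (x m) (y m) ⟩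
        100 * x m + 100 * y m       ∎))
      1≤y : ∀ m → 1 ≤ y m
      1≤y m = ≤-<-trans z≤n (y-above m)

    h≤ℓZ : h n ≤ ℓ * Z
    h≤ℓZ = h≤ (begin
      n                           ≤⟨ n≤N₂V ⟩
      N₂ * (16 * Z)               ≡⟨ solve (N₂ ∷ Z ∷ []) ⟩
      16 * N₂ * Z                 ≤⟨ *-monoˡ-≤ Z 16N₂≤10⁸ ⟩
      100000000 * Z               ≤⟨ *-monoʳ-≤ 100000000 (m≤n*m Z ℓ {{>-nonZero 1≤ℓ}}) ⟩
      100000000 * (ℓ * Z)         ≡⟨ *-comm 100000000 (ℓ * Z) ⟩
      ℓ * Z * 100000000           ∎)
      where open ≤-Reasoning

    solid-enough : EnoughPairs b n
    solid-enough = ℓ * Z , ordered-pairs x≤y ordered , h≤ℓZ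

  Chain : ℕ → List SolidCase → ℕ → Set
  Chain lo []       hi = hi ≤ lo
  Chain lo (c ∷ cs) hi = SolidCase.N₁ c ≤ lo × Chain (SolidCase.N₂ c) cs hi

  chain? : ∀ lo cs hi → Dec (Chain lo cs hi)
  chain? lo []       hi = hi ≤? lo
  chain? lo (c ∷ cs) hi = (SolidCase.N₁ c ≤? lo) ×-dec chain? (SolidCase.N₂ c) cs hi

  solid-cases : List SolidCase
  solid-cases =
      solid 16400 16640  7168  16 2 2 448-464 576-592 true
    ∷ solid 16640 16768  7296 128 2 2 448-464 576-592 true
    ∷ solid 16768 25600   256  64 0 3 256-432 256-432 true
    ∷ solid 25600 28672  1024 256 1 3 256-432 256-432 true
    ∷ solid 28672 34048  6400 512 2 3 256-432 256-432 true
    ∷ solid 34048 44032 16384 256 3 3 256-432 256-432 true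
    ∷ solid 44032 49648 22000  16 3 3 256-432 256-432 true
    ∷ solid 49648 52456 24808  16 3 3 256-432 256-432 true
    ∷ solid 52456 53860 26212  16 3 3 256-432 256-432 true
    ∷ solid 53860 54562 26914  16 3 3 256-432 256-432 true
    ∷ solid 54272 65472 37824  64 3 3 576-592 256-432 false
    ∷ []

  solid-cases-valid : All Valid solid-cases
  solid-cases-valid = from-yes (All.all? valid? solid-cases)

  solid-cases-chain : Chain 16400 solid-cases 65472
  solid-cases-chain = from-yes (chain? 16400 solid-cases 65472)

  -- n between 4^(9+f) = 16384V and 4^(10+f) = 65536V, with V = 16 · 4^f
  module Band (f : ℕ) (b : Bool) where

    V : ℕ
    V = 16 * 4 ^ f

    chain-enough : ∀ lo cs hi → Chain lo cs hi → All Valid cs →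
                   ∀ {n} → lo * V < n → n ≤ hi * V → EnoughPairs b n
    chain-enough lo [] hi hi≤lo All.[] lo·V<n n≤hi·V =
      contradiction (≤-trans n≤hi·V (*-monoˡ-≤ V hi≤lo)) (<⇒≱ lo·V<n)
    chain-enough lo (solid N₁ N₂ A ℓ jx jy rx ry o ∷ cs) hi (N₁≤lo , chain) (valid All.∷ valids) {n} lo·V<n n≤hi·V
      with n ≤? N₂ * V
    ... | yes n≤N₂V = SolidPairs.solid-enough f (4 ^ f) refl b N₁ N₂ A ℓ jx jy rx ry o valid
                        (≤-trans (*-monoˡ-≤ V N₁≤lo) (<⇒≤ lo·V<n)) n≤N₂V
    ... | no  n≰N₂V = chain-enough N₂ cs hi chain valids (≰⇒> n≰N₂V) n≤hi·V

    u₄ u₅ : ℕ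
    u₄ = 4 ^ (4 + f)
    u₅ = 4 ^ (5 + f)

    u₄≡16V : u₄ ≡ 16 * V
    u₄≡16V = powers (4 ^ f)
      where
      powers : ∀ z → 4 * (4 * (4 * (4 * z))) ≡ 16 * (16 * z)
      powers = solve-∀

    u₅≡64V : u₅ ≡ 64 * V
    u₅≡64V = powers (4 ^ f)
      where
      powers : ∀ z → 4 * (4 * (4 * (4 * (4 * z)))) ≡ 64 * (16 * z)
      powers = solve-∀

    -- n = 1024u + t with u = 4^(4+f) = 16V and 1 ≤ t ≤ u
    enough-above-16384V : ∀ {n} → 16384 * V < n → n ≤ 16400 * V → EnoughPairs b n
    enough-above-16384V {n} lo hi =
        mismatches (4 * u₄) t
      , ThueMorsePairs.tm-pairs (4 + f) u₄ refl b false t≤u balanced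
      , ThueMorsePairs.h≤mismatches (4 + f) u₄ refl 1≤t t≤u n≤1025u
      where
      open ≤-Reasoning
      t : ℕ
      t = n ∸ 16384 * V
      n≡ : 16384 * V + t ≡ n
      n≡ = m+[n∸m]≡n (<⇒≤ lo)
      1≤t : 1 ≤ t
      1≤t = m<n⇒0<n∸m lo
      16384V≡1024u : 16384 * V ≡ 1024 * u₄
      16384V≡1024u = trans (*-assoc 1024 16 V) (cong (1024 *_) (sym u₄≡16V))
      t≤u : t ≤ u₄
      t≤u = +-cancelˡ-≤ (16384 * V) t u₄ (begin
        16384 * V + t          ≡⟨ n≡ ⟩
        n                      ≤⟨ hi ⟩
        16400 * V              ≡⟨ *-distribʳ-+ V 16384 16 ⟩
        16384 * V + 16 * V     ≡⟨ cong (16384 * V +_) u₄≡16V ⟨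
        16384 * V + u₄         ∎)
      n≤1025u : n ≤ 1025 * u₄
      n≤1025u = ≤-trans hi (≤-reflexive (trans (*-assoc 1025 16 V) (cong (1025 *_) (sym u₄≡16V))))
      balanced : ∀ s → n + s ≡ 1024 * u₄ + (s + t)
      balanced s = begin-equality
        n + s                  ≡⟨ cong (_+ s) n≡ ⟨
        16384 * V + t + s      ≡⟨ +-assoc (16384 * V) t s ⟩
        16384 * V + (t + s)    ≡⟨ cong₂ _+_ 16384V≡1024u (+-comm t s) ⟩
        1024 * u₄ + (s + t)    ∎

    -- n + t = 1024u with u = 4^(5+f) = 64V and 1 ≤ t ≤ u
    enough-below-65536V : ∀ {n} → 65472 * V < n → n < 65536 * V → EnoughPairs b n
    enough-below-65536V {n} lo hi =
        mismatches (4 * u₅) t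
      , ThueMorsePairs.tm-pairs (5 + f) u₅ refl b true t≤u balanced
      , ThueMorsePairs.h≤mismatches (5 + f) u₅ refl 1≤t t≤u n≤1025u
      where
      open ≤-Reasoning
      t : ℕ
      t = 65536 * V ∸ n
      n+t≡ : n + t ≡ 65536 * V
      n+t≡ = m+[n∸m]≡n (<⇒≤ hi)
      1≤t : 1 ≤ t
      1≤t = m<n⇒0<n∸m hi
      65536V≡1024u : 65536 * V ≡ 1024 * u₅
      65536V≡1024u = trans (*-assoc 1024 64 V) (cong (1024 *_) (sym u₅≡64V))
      t≤u : t ≤ u₅
      t≤u = +-cancelˡ-≤ n t u₅ (begin
        n + t                  ≡⟨ n+t≡ ⟩
        65536 * V              ≡⟨ *-distribʳ-+ V 65472 64 ⟩
        65472 * V + 64 * V     ≤⟨ +-mono-≤ (<⇒≤ lo) (≤-reflexive (sym u₅≡64V)) ⟩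
        n + u₅                 ∎)
      n≤1025u : n ≤ 1025 * u₅
      n≤1025u = begin
        n                      ≤⟨ <⇒≤ hi ⟩
        65536 * V              ≡⟨ 65536V≡1024u ⟩
        1024 * u₅              ≤⟨ *-monoˡ-≤ u₅ (n≤1+n 1024) ⟩
        1025 * u₅              ∎
      balanced : ∀ s → n + (s + t) ≡ 1024 * u₅ + s
      balanced s = begin-equality
        n + (s + t)            ≡⟨ cong (n +_) (+-comm s t) ⟩
        n + (t + s)            ≡⟨ +-assoc n t s ⟨
        n + t + s              ≡⟨ cong (_+ s) (trans n+t≡ 65536V≡1024u) ⟩
        1024 * u₅ + s          ∎

    band-enough : ∀ {n} → 16384 * V < n → n < 65536 * V → EnoughPairs b n
    band-enough {n} lo hi = below-16400V (≤-<-connex n (16400 * V))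
      where
      below-65472V : n ≤ 65472 * V ⊎ 65472 * V < n → 16400 * V < n → EnoughPairs b n
      below-65472V (inj₁ n≤65472V) 16400V<n =
        chain-enough 16400 solid-cases 65472 solid-cases-chain solid-cases-valid 16400V<n n≤65472V
      below-65472V (inj₂ 65472V<n) _        = enough-below-65536V 65472V<n hi
      below-16400V : n ≤ 16400 * V ⊎ 16400 * V < n → EnoughPairs b n
      below-16400V (inj₁ n≤16400V) = enough-above-16384V lo n≤16400V
      below-16400V (inj₂ 16400V<n) = below-65472V (≤-<-connex n (65472 * V)) 16400V<n

  enough : ∀ b {n} → 4 ^ 9 ≤ n → (∀ i → 1 ≤ i → n ≢ 4 ^ suc i) → EnoughPairs b n
  enough b {suc n} 4⁹≤n not-power with power-band 4 (≤ᵇ⇒≤ 2 4 _) n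
  ... | q , 4^q≤n , n<4^[1+q] = Band.band-enough f b lo hi
    where
    9≤q : 9 ≤ q
    9≤q = ≮⇒≥ (λ q<9 → <⇒≱ (<-≤-trans n<4^[1+q] (^-monoʳ-≤ 4 q<9)) 4⁹≤n)
    f : ℕ
    f = q ∸ 9
    9+f≡q : 9 + f ≡ q
    9+f≡q = m+[n∸m]≡n 9≤q
    powers : ∀ z → (4 ^ 9 * z ≡ 16384 * (16 * z)) × (4 ^ 10 * z ≡ 65536 * (16 * z))
    powers z = solve (z ∷ []) , solve (z ∷ [])
    4^q≡ : 4 ^ q ≡ 16384 * (16 * 4 ^ f)
    4^q≡ = trans (cong (4 ^_) (sym 9+f≡q)) (trans (^-distribˡ-+-* 4 9 f) (proj₁ (powers (4 ^ f))))
    4^[1+q]≡ : 4 ^ suc q ≡ 65536 * (16 * 4 ^ f)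
    4^[1+q]≡ = trans (cong (4 ^_) (cong suc (sym 9+f≡q))) (trans (^-distribˡ-+-* 4 10 f) (proj₂ (powers (4 ^ f))))
    lo : 16384 * (16 * 4 ^ f) < suc n
    lo = ≤∧≢⇒< (subst (_≤ suc n) 4^q≡ 4^q≤n)
               (λ e → not-power (8 + f) (s≤s z≤n) (trans (sym e) (trans (sym 4^q≡) (cong (4 ^_) (sym 9+f≡q)))))
    hi : suc n < 65536 * (16 * 4 ^ f)
    hi = subst (suc n <_) 4^[1+q]≡ n<4^[1+q]

module Construction where

  open import Data.Bool.Base using (Bool; true; false)
  open import Data.Empty using (⊥; ⊥-elim)
  open import Data.Fin.Base using (Fin; toℕ; inject≤)
  open import Data.Fin.Properties using (inject≤-injective)
  open import Data.Integer.Base as ℤ using (ℤ; +_; +<+; +≤+)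
  import Data.Integer.Properties as ℤ
  open import Data.Nat.Base
  open import Data.Nat.Properties
  open import Data.Nat.Tactic.RingSolver using (solve-∀)
  open import Data.Product.Base using (Σ; ∃-syntax; _×_; _,_; proj₁; proj₂)
  open import Data.Sum.Base using (_⊎_; inj₁; inj₂; swap)
  open import Data.Vec.Base using (lookup)
  open import Function.Base using (_∘_)
  open import Relation.Binary.Definitions using (Tri; tri<; tri≈; tri>)
  open import Relation.Binary.PropositionalEquality
  open import Relation.Nullary.Negation using (contradiction)
  open import Relation.Unary using (_∈_)
  open import Defs
  open Preliminaries
  open Levels
  open Representations

  member-band : ∀ {b e y} → Member b (4 ^ e) y → 4 ^ (4 + e) < y × y < 3 * 4 ^ (4 + e)
  member-band {e = e} {y} y∈ =
      subst (_< y) (sym (4^[4+e] (4 ^ e))) (proj₁ (member-range y∈))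
    , subst (y <_) (trans (*-assoc 3 256 (4 ^ e)) (cong (3 *_) (sym (4^[4+e] (4 ^ e))))) (proj₂ (member-range y∈))
    where
    instance
      u≢0 : NonZero (4 ^ e)
      u≢0 = m^n≢0 4 e
    4^[4+e] : ∀ z → 4 * (4 * (4 * (4 * z))) ≡ 256 * z
    4^[4+e] = solve-∀

  r′≥-weaken : ∀ {A n k K} → k ≤ K → r′≥ A n K → r′≥ A n k
  r′≥-weaken k≤K (f , f-injective , reps) =
      (λ i → f (inject≤ i k≤K))
    , (λ e → inject≤-injective k≤K k≤K _ _ (f-injective e))
    , (λ i → reps (inject≤ i k≤K))

  r′≥-fromPairs : ∀ {P : ℕ → Set} {A n K} → (∀ y → P y → + y ∈ A) → Pairs P n K → r′≥ A n K
  r′≥-fromPairs {P} {A} {n} P⊆A (f , f-injective , pairs) =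
    lift ∘ f , (λ e → f-injective (lift-injective e)) , rep ∘ pairs
    where
    lift : ℕ × ℕ → ℤ × ℤ
    lift (y , y′) = + y , + y′
    lift-injective : ∀ {p q} → lift p ≡ lift q → p ≡ q
    lift-injective {_ , _} {_ , _} refl = refl
    rep : ∀ {p} → Pair P n p → Rep A n (lift p)
    rep {y , y′} (y∈ , y′∈ , sum , 1≤y , y≤y′ , y′≤100y) =
        P⊆A y y∈ , P⊆A y′ y′∈ , cong +_ sum , +<+ 1≤y , +≤+ y≤y′
      , subst (+ y′ ℤ.≤_) (sym (ℤ.+◃n≡+n (100 * y))) (+≤+ y′≤100y)

  -- B_k and C_k are empty for k ≤ 2; for k = e + 3 they form the level with unit 4^e.
  levelSet : Bool → ℕ → ISet
  levelSet b (suc (suc (suc e))) x = Σ ℕ λ y → x ≡ + y × Member b (4 ^ e) y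
  levelSet b _                   x = ⊥

  levelSet-bounds : ∀ b k x → x ∈ levelSet b k → (+ 0 ℤ.< x) × (N k ℤ.< x) × (x ℤ.< N (suc k))
  levelSet-bounds b (suc (suc (suc e))) .(+ y) (y , refl , y∈) =
    +<+ (≤-<-trans z≤n (proj₁ band)) , +<+ (proj₁ band) , +<+ (<-≤-trans (proj₂ band) (scale-≤ 3 4 (4 ^ (4 + e))))
    where
    band : 4 ^ (4 + e) < y × y < 3 * 4 ^ (4 + e)
    band = member-band {e = e} y∈
  levelSet-bounds b (suc (suc zero)) x ()
  levelSet-bounds b (suc zero)       x ()
  levelSet-bounds b zero             x ()

  N-increasing : ∀ j → N (suc j) ℤ.< N (suc (suc j))
  N-increasing j = +<+ (^-monoʳ-< 4 (≤ᵇ⇒≤ 2 4 _) (n<1+n (suc (suc j))))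

  module Outcome (S : Mech) (S-valid : ValidMech S) where

    open Run S (levelSet true) (levelSet false)

    lookup-hist : ∀ m (j : Fin m) → lookup (hist m) j ≡ step (toℕ j) (hist (toℕ j))
    lookup-hist (suc m) j with lookup-∷ʳ (hist m) (step m (hist m)) j
    ... | inj₁ (j′ , j′≡j , e) = trans e (trans (lookup-hist m j′) (cong (λ t → step t (hist t)) j′≡j))
    ... | inj₂ (j≡m , e)       = trans e (cong (λ t → step t (hist t)) (sym j≡m))

    earlier-B earlier-C earlier-G earlier-H : ∀ i → Fin i → ISet
    earlier-B i j = levelSet true (suc (toℕ j))
    earlier-C i j = levelSet false (suc (toℕ j))
    earlier-G i j = proj₁ (lookup (hist i) j)
    earlier-H i j = proj₂ (lookup (hist i) j)

    Out : Bool → ℕ → ISet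
    Out true  = Gs
    Out false = Hs

    Big : Bool → ISet
    Big b x = ∃[ i ] (x ∈ levelSet b (suc i) ⊎ x ∈ (N (suc (suc i)) -ˢ Out b (suc i)))

    Out⊆F : ∀ b i x → x ∈ Out b i → x ∈ Fs i
    Out⊆F true  i x = inj₁
    Out⊆F false i x = inj₂

    source : ∀ b i x → x ∈ Out b (suc i) →
             Σ (Fin i) λ j → x ∈ levelSet b (suc (toℕ j))
                           ⊎ x ∈ (N (suc (suc (toℕ j))) -ˢ Out b (suc (toℕ j)))
    source true  i x x∈ with proj₁ (S-valid i (earlier-B i) (earlier-C i) (earlier-G i) (earlier-H i)) x x∈
    ... | j , inj₁ x∈B = j , inj₁ x∈B
    ... | j , inj₂ x∈R = j , inj₂ (subst (λ v → _ ∈ proj₁ v) (lookup-hist i j) x∈R)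
    source false i x x∈ with proj₁ (proj₂ (S-valid i (earlier-B i) (earlier-C i) (earlier-G i) (earlier-H i))) x x∈
    ... | j , inj₁ x∈C = j , inj₁ x∈C
    ... | j , inj₂ x∈R = j , inj₂ (subst (λ v → _ ∈ proj₂ v) (lookup-hist i j) x∈R)

    G-H-disjoint : ∀ i x → x ∈ Gs (suc i) → x ∈ Hs (suc i) → ⊥
    G-H-disjoint i = proj₁ (proj₂ (proj₂ (S-valid i (earlier-B i) (earlier-C i) (earlier-G i) (earlier-H i))))

    Out-bounded : ∀ b i x → x ∈ Out b (suc i) → x ℤ.≤ N (suc i)
    Out-bounded true  i x x∈ =
      proj₂ (proj₂ (proj₂ (S-valid i (earlier-B i) (earlier-C i) (earlier-G i) (earlier-H i)))) x (inj₁ x∈)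
    Out-bounded false i x x∈ =
      proj₂ (proj₂ (proj₂ (S-valid i (earlier-B i) (earlier-C i) (earlier-G i) (earlier-H i)))) x (inj₂ x∈)

    Out-positive : ∀ b i x → x ∈ Out b (suc i) → + 0 ℤ.< x
    Out-positive b i x x∈ with source b i x x∈
    ... | j , inj₁ x∈base = proj₁ (levelSet-bounds b (suc (toℕ j)) x x∈base)
    ... | j , inj₂ x∈refl = i-j<i⇒0<j (N (suc (suc (toℕ j)))) x
                              (ℤ.≤-<-trans (Out-bounded b (toℕ j) _ x∈refl) (N-increasing (toℕ j)))

    -- Elements are sorted into bands [4^p, 4^(p+1)): B_k ∪ C_k (k = e + 3)
    -- lies in band e + 4, below 3 · 4^p, and N_{i+2} − F_{i+1} in band i + 2,
    -- from 3 · 4^p on.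
    data Located (b : Bool) : ℕ → ℕ → Set where
      base      : ∀ {e y} → Member b (4 ^ e) y → Located b (4 + e) y
      reflected : ∀ {i y g} → + g ∈ Out b (suc i) → 1 ≤ g → g ≤ 4 ^ (2 + i) → y + g ≡ 4 ^ (3 + i) →
                  Located b (2 + i) y

    locate : ∀ b x → x ∈ Big b → Σ ℕ λ y → x ≡ + y × ∃[ p ] Located b p y
    locate b x (suc (suc e) , inj₁ (y , x≡y , y∈)) = y , x≡y , 4 + e , base y∈
    locate b x (i , inj₂ g∈) = reflected-at (Out-positive b i _ g∈) (Out-bounded b i _ g∈) g∈ refl
      where
      reflected-at : ∀ {z} → + 0 ℤ.< z → z ℤ.≤ N (suc i) → z ∈ Out b (suc i) →
                     N (suc (suc i)) ℤ.- x ≡ z → Σ ℕ λ y → x ≡ + y × ∃[ p ] Located b p y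
      reflected-at (+<+ {n = g} 1≤g) (+≤+ g≤4^[2+i]) g∈ a-x≡g =
        4 ^ (3 + i) ∸ g , +m-i≡+n⇒i≡+[m∸n] (4 ^ (3 + i)) x g a-x≡g g≤4^[3+i] , 2 + i ,
        reflected g∈ 1≤g g≤4^[2+i] (m∸n+n≡m g≤4^[3+i])
        where
        g≤4^[3+i] : g ≤ 4 ^ (3 + i)
        g≤4^[3+i] = ≤-trans g≤4^[2+i] (m≤n*m (4 ^ (2 + i)) 4)

    located-band : ∀ {b p y} → Located b p y → 4 ^ p ≤ y × y < 4 ^ suc p
    located-band (base {e} y∈) =
      <⇒≤ (proj₁ (member-band {e = e} y∈)) , <-≤-trans (proj₂ (member-band {e = e} y∈)) (scale-≤ 3 4 (4 ^ (4 + e)))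
    located-band (reflected {i} {y} _ 1≤g g≤ y+g) = ≤-trans (m≤n*m (4 ^ (2 + i)) 3) (proj₁ band) , proj₂ band
      where
      band : 3 * 4 ^ (2 + i) ≤ y × y < 4 * 4 ^ (2 + i)
      band = complement-band y+g 1≤g g≤

    located-disjoint : ∀ {p q y} → Located true p y → Located false q y → ⊥
    located-disjoint {p} {q} loc loc′
      with power-band-unique 4 {p} {q} (proj₁ (located-band loc)) (proj₂ (located-band loc))
                                       (proj₁ (located-band loc′)) (proj₂ (located-band loc′))
    ... | refl = same-band loc loc′
      where
      same-band : ∀ {p y} → Located true p y → Located false p y → ⊥
      same-band (base {e} y∈) (base y∈′) = contradiction (member-class-unique {{m^n≢0 4 e}} y∈ y∈′) λ ()
      same-band (base {e} y∈) (reflected _ 1≤g g≤ y+g) =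
        <⇒≱ (proj₂ (member-band {e = e} y∈)) (proj₁ (complement-band y+g 1≤g g≤))
      same-band (reflected _ 1≤g g≤ y+g) (base {e} y∈) =
        <⇒≱ (proj₂ (member-band {e = e} y∈)) (proj₁ (complement-band y+g 1≤g g≤))
      same-band (reflected {i} {y} {g} g∈ _ _ y+g) (reflected {g = g′} g′∈ _ _ y+g′) =
        G-H-disjoint i (+ g) g∈ (subst (λ v → + v ∈ Hs (suc i)) (+-cancelˡ-≡ y g′ g (trans y+g′ (sym y+g))) g′∈)

    base-pair : ∀ {b b′ e p′ y y′} → Member b (4 ^ e) y → Located b′ p′ y′ →
                y + y′ ≡ 4 ^ (5 + e) → p′ ≡ 4 + e → + y ∈ Fs (3 + e) ⊎ + y′ ∈ Fs (3 + e)
    base-pair {e = e} y∈ (base y′∈) y+y′ refl =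
      ⊥-elim (member-sum-free {{m^n≢0 4 e}} y∈ y′∈ (trans y+y′ (4^[5+e] (4 ^ e))))
      where
      4^[5+e] : ∀ z → 4 * (4 * (4 * (4 * (4 * z)))) ≡ 1024 * z
      4^[5+e] = solve-∀
    base-pair {b′ = b′} {e} {y = y} {y′} y∈ (reflected {g = g} g∈ _ _ y′+g) y+y′ refl =
      inj₁ (Out⊆F b′ (3 + e) _ (subst (λ v → + v ∈ Out b′ (3 + e)) g≡y g∈))
      where
      g≡y : g ≡ y
      g≡y = +-cancelˡ-≡ y′ _ _ (trans y′+g (trans (sym y+y′) (+-comm y y′)))

    -- A sum 4^(k+2) = N_{k+1} with a summand in band k + 1: if that summand is a
    -- reflection of g ∈ F_k, the other one is g; if it is a base element, the other
    -- summand is in band k + 1 too, where two base elements never sum to 1024u.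
    top-band-sum : ∀ {b b′ k p′ y y′} → Located b (suc k) y → Located b′ p′ y′ →
                   y + y′ ≡ 4 ^ suc (suc k) → + y ∈ Fs k ⊎ + y′ ∈ Fs k
    top-band-sum {b} {y = y} (reflected {i} g∈ _ _ y+g) _ y+y′ =
      inj₂ (Out⊆F b (suc i) _ (subst (λ v → + v ∈ Out b (suc i)) (+-cancelˡ-≡ y _ _ (trans y+g (sym y+y′))) g∈))
    top-band-sum {p′ = p′} {y} {y′} (base {e} y∈) loc′ y+y′ =
      base-pair y∈ loc′ y+y′
        (power-band-unique 4 {p′} {4 + e} (proj₁ (located-band loc′)) (proj₂ (located-band loc′)) P≤y′ y′<4P)
      where
      P : ℕ
      P = 4 ^ (4 + e)
      P≤y′ : P ≤ y′
      P≤y′ = <⇒≤ (+-<-swap (trans y+y′ (4*m≡3*m+m P)) (proj₂ (member-band {e = e} y∈)))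
      y′<4P : y′ < 4 * P
      y′<4P = <-≤-trans (m<n+m y′ (≤-<-trans z≤n (proj₁ (member-band {e = e} y∈)))) (≤-reflexive y+y′)

    located-sum : ∀ k {b b′ p p′ y y′} → Located b p y → Located b′ p′ y′ →
                  y + y′ ≡ 4 ^ suc (suc k) → + y ∈ Fs k ⊎ + y′ ∈ Fs k
    located-sum k {p = p} {p′} {y} {y′} loc loc′ y+y′ = by-bands (<-cmp p (suc k)) (<-cmp p′ (suc k))
      where
      4^p≤y : 4 ^ p ≤ y
      4^p≤y = proj₁ (located-band loc)
      y<4^[1+p] : y < 4 ^ suc p
      y<4^[1+p] = proj₂ (located-band loc)
      4^p′≤y′ : 4 ^ p′ ≤ y′
      4^p′≤y′ = proj₁ (located-band loc′)
      y′<4^[1+p′] : y′ < 4 ^ suc p′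
      y′<4^[1+p′] = proj₂ (located-band loc′)
      too-big : ∀ {p y y′} → suc k < p → 4 ^ p ≤ y → 0 < y′ → y + y′ ≡ 4 ^ suc (suc k) → ⊥
      too-big k+1<p 4^p≤y 0<y′ sum =
        <⇒≢ (<-≤-trans (≤-<-trans (≤-trans (^-monoʳ-≤ 4 k+1<p) 4^p≤y) (m<m+n _ 0<y′)) (≤-reflexive sum)) refl
      by-bands : Tri (p < suc k) (p ≡ suc k) (suc k < p) → Tri (p′ < suc k) (p′ ≡ suc k) (suc k < p′) →
                 + y ∈ Fs k ⊎ + y′ ∈ Fs k
      by-bands (tri≈ _ refl _) _ = top-band-sum loc loc′ y+y′
      by-bands _ (tri≈ _ refl _) = swap (top-band-sum loc′ loc (trans (+-comm y′ y) y+y′))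
      by-bands (tri> _ _ k+1<p) _ = ⊥-elim (too-big k+1<p 4^p≤y (≤-trans (m^n>0 4 p′) 4^p′≤y′) y+y′)
      by-bands _ (tri> _ _ k+1<p′) =
        ⊥-elim (too-big k+1<p′ 4^p′≤y′ (≤-trans (m^n>0 4 p) 4^p≤y) (trans (+-comm y′ y) y+y′))
      by-bands (tri< p<k+1 _ _) (tri< p′<k+1 _ _) = ⊥-elim (<⇒≢ (begin-strict
        y + y′                          <⟨ +-mono-< (<-≤-trans y<4^[1+p] (^-monoʳ-≤ 4 p<k+1))
                                                    (<-≤-trans y′<4^[1+p′] (^-monoʳ-≤ 4 p′<k+1)) ⟩
        4 ^ suc k + 4 ^ suc k           ≡⟨ 2*m≡m+m (4 ^ suc k) ⟨
        2 * 4 ^ suc k                   <⟨ *-monoˡ-< (4 ^ suc k) {{m^n≢0 4 (suc k)}} (≤ᵇ⇒≤ 3 4 _) ⟩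
        4 ^ suc (suc k)                 ∎) y+y′)
        where open ≤-Reasoning

    InBase⊆Big : ∀ b y → InBase b y → + y ∈ Big b
    InBase⊆Big b y (e , y∈) = suc (suc e) , inj₁ (y , refl , y∈)

    Big-disjoint : ∀ x → x ∈ Big true → x ∈ Big false → ⊥
    Big-disjoint x x∈B x∈C with locate true x x∈B | locate false x x∈C
    ... | y , refl , _ , loc | y′ , x≡y′ , _ , loc′ =
      located-disjoint loc (subst (Located false _) (sym (ℤ.+-injective x≡y′)) loc′)

    Big-dense : ∀ b n → 4 ^ 9 ≤ n → (∀ i → 1 ≤ i → n ≢ 4 ^ suc i) → r′≥ (Big b) n (h n)
    Big-dense b n 4⁹≤n not-power with enough b 4⁹≤n not-power
    ... | K , pairs , h≤K = r′≥-weaken {Big b} h≤K (r′≥-fromPairs {InBase b} {Big b} (InBase⊆Big b) pairs)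

    locate-either : ∀ x → (x ∈ Big true ⊎ x ∈ Big false) → Σ Bool λ b → Σ ℕ λ y → x ≡ + y × ∃[ p ] Located b p y
    locate-either x (inj₁ x∈) = true , locate true x x∈
    locate-either x (inj₂ x∈) = false , locate false x x∈

    Big-sum : ∀ k a a′ → (a ∈ Big true ⊎ a ∈ Big false) → (a′ ∈ Big true ⊎ a′ ∈ Big false) →
              a ℤ.+ a′ ≡ N (suc k) → a ∈ Fs k ⊎ a′ ∈ Fs k
    Big-sum k a a′ a∈ a′∈ a+a′ with locate-either a a∈ | locate-either a′ a′∈
    ... | _ , y , refl , _ , loc | _ , y′ , refl , _ , loc′ = located-sum k loc loc′ (ℤ.+-injective a+a′)

open import Defs
open import Data.Nat as ℕ using (ℕ; suc; _≤_)
open import Data.Integer as ℤ using (ℤ; +_; _+_; _<_)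
open import Data.Product using (Σ; ∃-syntax; _×_; _,_)
open import Data.Sum using (_⊎_)
open import Data.Empty using (⊥)
open import Relation.Unary using (_∈_)
open import Relation.Binary.PropositionalEquality using (_≡_; _≢_)
open import Data.Bool.Base using (true; false)
open Construction

theorem2 : (S : Mech) → ValidMech S →
    Σ (ℕ → ISet) λ Bs → Σ (ℕ → ISet) λ Cs →
      -- 1.
      (∀ k → 1 ≤ k → ∀ x →
          (x ∈ Bs k → (+ 0 < x) × (N k < x) × (x < N (suc k)))
        × (x ∈ Cs k → (+ 0 < x) × (N k < x) × (x < N (suc k))))
      -- 2.
    × (∀ x → x ∈ Run.BigB S Bs Cs → x ∈ Run.BigC S Bs Cs → ⊥)
      -- 3.
    × (∃[ n₀ ] ∀ n → n₀ ≤ n → (∀ i → 1 ≤ i → n ≢ 4 ℕ.^ suc i) →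
          r′≥ (Run.BigB S Bs Cs) n (h n) × r′≥ (Run.BigC S Bs Cs) n (h n))
      -- 4.
    × (∃[ k₀ ] ∀ k → k₀ ≤ k → 1 ≤ k → ∀ a a′ →
          (a ∈ Run.BigB S Bs Cs ⊎ a ∈ Run.BigC S Bs Cs) →
          (a′ ∈ Run.BigB S Bs Cs ⊎ a′ ∈ Run.BigC S Bs Cs) →
          a + a′ ≡ N (suc k) →
          a ∈ Run.Fs S Bs Cs k ⊎ a′ ∈ Run.Fs S Bs Cs k)
theorem2 S S-valid =
    levelSet true , levelSet false
  , (λ k _ x → levelSet-bounds true k x , levelSet-bounds false k x)
  , Big-disjoint
  , (4 ℕ.^ 9 , λ n 4⁹≤n not-power → Big-dense true n 4⁹≤n not-power , Big-dense false n 4⁹≤n not-power)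
  , (0 , λ k _ _ → Big-sum k)
  where open Outcome S S-valid
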